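{- Let $d\geq 3$, let $q$ be a prime power, $t\in\mathbb{F}_q$ nonzero, and $E\subseteq\mathbb{F}_q^d$. Let $\mathcal{N}_d(E)$ be the number of $(d+1)$-tuples $(y,x_1,\dots,x_d)\in E^{d+1}$ such that $y\cdot x_i=t$ for all $i=1,\dots,d$ and $\{x_1,\dots,x_d\}$ is a linearly independent set of $d$ vectors. There is a constant $C_d$ depending only on $d$ such that if $|E|\geq C_d\,q^{d-\frac{1}{d-1}}$ and $q$ is sufficiently large, then $$\mathcal{N}_d(E)\geq\frac{|E|^{d+1}}{3q^d}.$$
   Context: For $x,y\in\mathbb{F}_q^d$, $x\cdot y=\sum_{i=1}^d x_iy_i$. Such a tuple $(y,x_1,\dots,x_d)$ is called a $d$-star in the dot-product graph on $E$ (the graph on vertex set $E$ with $x\sim y$ iff $x\cdot y=t$), and $\{x_1,\dots,x_d\}$ is its leaf set. -}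

module Defs where

open import Level using (0ℓ)
open import Data.Nat using (ℕ)
open import Data.Fin using (Fin)
open import Data.Product using (_×_; Σ; _,_)
open import Data.List using (List; length)
open import Data.List.Membership.Propositional using (_∈_)
open import Data.List.Relation.Unary.Unique.Propositional using (Unique)
open import Data.Vec.Relation.Unary.All using (All)
open import Data.Vec using (Vec; foldr; zipWith; replicate; lookup)
open import Algebra.Structures using (IsCommutativeRing)
open import Relation.Binary.PropositionalEquality using (_≡_; _≢_)
open import Relation.Binary.Definitions using (DecidableEquality)

-- Its order q = |elements| is automatically a prime power, and every
-- finite field arises this way.
record FiniteField : Set₁ where
  infixl 6 _+_
  infixl 7 _*_
  field
    Carrier : Set
    _+_ _*_ : Carrier → Carrier → Carrier
    -_      : Carrier → Carrier
    0# 1#   : Carrier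
    isCommutativeRing : IsCommutativeRing _≡_ _+_ _*_ -_ 0# 1#
    0≢1     : 0# ≢ 1#
    inverse : ∀ x → x ≢ 0# → Σ Carrier (λ y → x * y ≡ 1#)
    _≟_     : DecidableEquality Carrier
    elements : List Carrier
    complete : ∀ x → x ∈ elements
    unique   : Unique elements

  order : ℕ
  order = length elements

module _ (F : FiniteField) where
  open FiniteField F

  Pt : ℕ → Set
  Pt d = Vec Carrier d

  dot : ∀ {d} → Pt d → Pt d → Carrier
  dot x y = foldr _ _+_ 0# (zipWith _*_ x y)

  _·ₛ_ : ∀ {d} → Carrier → Pt d → Pt d
  c ·ₛ x = Data.Vec.map (c *_) x

  _+ᵥ_ : ∀ {d} → Pt d → Pt d → Pt d
  x +ᵥ y = zipWith _+_ x y

  lincomb : ∀ {d k} → Vec Carrier k → Vec (Pt d) k → Pt d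
  lincomb {d} c xs = foldr _ _+ᵥ_ (replicate d 0#) (zipWith _·ₛ_ c xs)

  LinIndep : ∀ {d k} → Vec (Pt d) k → Set
  LinIndep {d} {k} xs =
    ∀ (c : Vec Carrier k) → lincomb c xs ≡ replicate d 0# → c ≡ replicate k 0#

  IsIndepStar : ∀ {d} → List (Pt d) → Carrier → Pt d × Vec (Pt d) d → Set
  IsIndepStar {d} E t (y , xs) =
    (y ∈ E) × All (_∈ E) xs × (∀ (i : Fin d) → dot y (lookup xs i) ≡ t) × LinIndep xs

module Submission where

-- For y ∈ E let A_y = {x ∈ E : y·x = t}. Since t ≠ 0, a vector of A_y that is linearly dependent
-- on independent x₁, …, x_k ∈ A_y is an affine combination of them, and for k < d there are at
-- most q^(d−2) of those; so choosing leaves greedily gives at least (|A_y| − q^(d−2))^d independent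
-- d-stars centred at y, and by the power mean inequality n^(d−1) 𝒩_d(E) ≥ (Σ_y (|A_y| − q^(d−2)))^d,
-- where n = |E|. Two non-parallel affine hyperplanes of 𝔽_q^d meet in q^(d−2) points, so a second
-- moment count of the incidences y·x = t over all x ∈ 𝔽_q^d gives Σ_y |A_y| ≥ n(n − 1)/q − n q^(d−2).
-- The density hypothesis forces n ≥ 6d q^(d−1), whence Σ_y (|A_y| − q^(d−2)) ≥ (1 − 1/2d) n²/q,
-- and (1 − 1/2d)^(−d) ≤ 2 yields 𝒩_d(E) ≥ n^(d+1) / 2q^d.

open import Defs
open import Data.Nat using (ℕ; suc)
open import Data.Product using (Σ; _×_; _,_)
open import Data.List using (List; length)
open import Data.List.Membership.Propositional using (_∈_)
open import Data.List.Relation.Unary.Unique.Propositional using (Unique)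
open import Data.Vec using (Vec)
open import Function.Bundles using (_⇔_)
open import Relation.Binary.PropositionalEquality using (_≢_)

module Sums where

  open import Data.Nat using (_+_; _*_; _∸_; _≤_; z≤n; s≤s)
  open import Data.Nat.Properties
  open import Algebra.Properties.CommutativeSemigroup +-commutativeSemigroup using (interchange; x∙yz≈y∙xz)
  open import Data.List using ([]; _∷_; _++_; map; concatMap; filter)
  open import Data.List.Membership.Propositional using (find)
  open import Data.List.Membership.Propositional.Properties
    using (∈-filter⁻; ∈-concatMap⁻; ∈-∃++; ∈-++⁻; ∈-++⁺ˡ; ∈-++⁺ʳ)
  open import Data.List.Relation.Unary.Any using (here; there)
  import Data.List.Relation.Unary.All as All
  open import Data.List.Relation.Unary.AllPairs using ([]; _∷_)
  import Data.List.Relation.Unary.Unique.Propositional.Properties as Unique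
  open import Data.List.Relation.Binary.Subset.Propositional using (_⊆_)
  open import Data.Product using (proj₂)
  open import Data.Sum using (inj₁; inj₂)
  open import Data.Empty using (⊥; ⊥-elim)
  open import Relation.Nullary using (Dec; yes; no; ¬_; ¬?)
  open import Level using (0ℓ)
  open import Relation.Unary using (Pred; Decidable)
  open import Relation.Binary.Definitions using (DecidableEquality)
  open import Relation.Binary.PropositionalEquality

  ∑ : {A : Set} → List A → (A → ℕ) → ℕ
  ∑ []       f = 0
  ∑ (x ∷ xs) f = f x + ∑ xs f

  -- ∑ binds tighter than the arithmetic operators: a compound summand must be parenthesised.
  infix 9 ∑
  syntax ∑ xs (λ x → e) = ∑[ x ∈ xs ] e

  𝟙 : {P : Set} → Dec P → ℕ
  𝟙 (yes _) = 1
  𝟙 (no _)  = 0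

  𝟙≤1 : {P : Set} (p : Dec P) → 𝟙 p ≤ 1
  𝟙≤1 (yes _) = s≤s z≤n
  𝟙≤1 (no _)  = z≤n

  𝟙-≡1 : {P : Set} (p : Dec P) → P → 𝟙 p ≡ 1
  𝟙-≡1 (yes _) _ = refl
  𝟙-≡1 (no ¬p) p = ⊥-elim (¬p p)

  𝟙-≡0 : {P : Set} (p : Dec P) → ¬ P → 𝟙 p ≡ 0
  𝟙-≡0 (yes p) ¬p = ⊥-elim (¬p p)
  𝟙-≡0 (no _)  _  = refl

  𝟙-cong : {P Q : Set} (p : Dec P) (q : Dec Q) → (P → Q) → (Q → P) → 𝟙 p ≡ 𝟙 q
  𝟙-cong (yes _) (yes _) _ _ = refl
  𝟙-cong (yes p) (no ¬q) f _ = ⊥-elim (¬q (f p))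
  𝟙-cong (no ¬p) (yes q) _ g = ⊥-elim (¬p (g q))
  𝟙-cong (no _)  (no _)  _ _ = refl

  𝟙-idem : {P : Set} (p : Dec P) → 𝟙 p * 𝟙 p ≡ 𝟙 p
  𝟙-idem (yes _) = refl
  𝟙-idem (no _)  = refl

  𝟙*𝟙-cong : {P Q Q′ : Set} (p : Dec P) (q : Dec Q) (q′ : Dec Q′) →
              (P → Q → Q′) → (P → Q′ → Q) → 𝟙 p * 𝟙 q ≡ 𝟙 p * 𝟙 q′
  𝟙*𝟙-cong (yes p) q q′ f g = cong (_+ 0) (𝟙-cong q q′ (f p) (g p))
  𝟙*𝟙-cong (no _)  _ _  _ _ = refl

  𝟙+𝟙¬ : {P : Set} (p : Dec P) → 𝟙 p + 𝟙 (¬? p) ≡ 1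
  𝟙+𝟙¬ (yes _) = refl
  𝟙+𝟙¬ (no _)  = refl

  module _ {A : Set} where

    ∑-cong : (xs : List A) {f g : A → ℕ} → (∀ x → f x ≡ g x) → ∑ xs f ≡ ∑ xs g
    ∑-cong []       h = refl
    ∑-cong (x ∷ xs) h = cong₂ _+_ (h x) (∑-cong xs h)

    ∑-mono : (xs : List A) {f g : A → ℕ} → (∀ x → f x ≤ g x) → ∑ xs f ≤ ∑ xs g
    ∑-mono []       h = z≤n
    ∑-mono (x ∷ xs) h = +-mono-≤ (h x) (∑-mono xs h)

    ∑-+ : (xs : List A) (f g : A → ℕ) → ∑[ x ∈ xs ] (f x + g x) ≡ ∑ xs f + ∑ xs g
    ∑-+ []       f g = refl
    ∑-+ (x ∷ xs) f g rewrite ∑-+ xs f g = interchange (f x) (g x) _ _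

    ∑-*ˡ : (c : ℕ) (xs : List A) (f : A → ℕ) → ∑[ x ∈ xs ] (c * f x) ≡ c * ∑ xs f
    ∑-*ˡ c []       f = sym (*-zeroʳ c)
    ∑-*ˡ c (x ∷ xs) f rewrite ∑-*ˡ c xs f = sym (*-distribˡ-+ c (f x) _)

    ∑-*ʳ : (c : ℕ) (xs : List A) (f : A → ℕ) → ∑[ x ∈ xs ] (f x * c) ≡ ∑ xs f * c
    ∑-*ʳ c xs f = begin
      ∑[ x ∈ xs ] (f x * c) ≡⟨ ∑-cong xs (λ x → *-comm (f x) c) ⟩
      ∑[ x ∈ xs ] (c * f x) ≡⟨ ∑-*ˡ c xs f ⟩
      c * ∑ xs f            ≡⟨ *-comm c _ ⟩
      ∑ xs f * c            ∎
      where open ≡-Reasoning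

    ∑-const : (xs : List A) (c : ℕ) → ∑[ _ ∈ xs ] c ≡ length xs * c
    ∑-const []       c = refl
    ∑-const (x ∷ xs) c = cong (c +_) (∑-const xs c)

    ∑-0 : (xs : List A) (f : A → ℕ) → (∀ x → f x ≡ 0) → ∑ xs f ≡ 0
    ∑-0 xs f h = trans (∑-cong xs h) (trans (∑-const xs 0) (*-zeroʳ (length xs)))

    length≡∑1 : (xs : List A) → length xs ≡ ∑[ _ ∈ xs ] 1
    length≡∑1 xs = sym (trans (∑-const xs 1) (*-identityʳ (length xs)))

    ∑-++ : (xs ys : List A) (f : A → ℕ) → ∑ (xs ++ ys) f ≡ ∑ xs f + ∑ ys f
    ∑-++ []       ys f = refl
    ∑-++ (x ∷ xs) ys f rewrite ∑-++ xs ys f = sym (+-assoc (f x) _ _)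

    ∑-∸ : (xs : List A) (f g : A → ℕ) → ∑ xs f ∸ ∑ xs g ≤ ∑[ x ∈ xs ] (f x ∸ g x)
    ∑-∸ xs f g = m≤n+o⇒m∸n≤o (∑ xs f) (∑ xs g) (begin
      ∑ xs f                           ≤⟨ ∑-mono xs (λ x → m≤n+m∸n (f x) (g x)) ⟩
      ∑[ x ∈ xs ] (g x + (f x ∸ g x))  ≡⟨ ∑-+ xs g (λ x → f x ∸ g x) ⟩
      ∑ xs g + ∑[ x ∈ xs ] (f x ∸ g x) ∎)
      where open ≤-Reasoning

    ∈⇒≤∑ : {x : A} {xs : List A} (f : A → ℕ) → x ∈ xs → f x ≤ ∑ xs f
    ∈⇒≤∑ f (here refl) = m≤m+n _ _
    ∈⇒≤∑ f (there p)   = ≤-trans (∈⇒≤∑ f p) (m≤n+m _ _)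

    ∈-remove : {x y : A} (ys zs : List A) → y ∈ ys ++ x ∷ zs → y ≢ x → y ∈ ys ++ zs
    ∈-remove ys zs p y≢x with ∈-++⁻ ys p
    ... | inj₁ p          = ∈-++⁺ˡ p
    ... | inj₂ (here y≡x) = ⊥-elim (y≢x y≡x)
    ... | inj₂ (there p)  = ∈-++⁺ʳ ys p

    ∑-⊆ : (xs ys : List A) (f : A → ℕ) → Unique xs → xs ⊆ ys → ∑ xs f ≤ ∑ ys f
    ∑-⊆ []       ys f _            _     = z≤n
    ∑-⊆ (x ∷ xs) ys f (x∉xs ∷ !xs) xs⊆ys with zs₁ , zs₂ , refl ← ∈-∃++ (xs⊆ys (here refl)) = begin
      f x + ∑ xs f              ≤⟨ +-monoʳ-≤ (f x) (∑-⊆ xs (zs₁ ++ zs₂) f !xs xs⊆zs) ⟩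
      f x + ∑ (zs₁ ++ zs₂) f    ≡⟨ cong (f x +_) (∑-++ zs₁ zs₂ f) ⟩
      f x + (∑ zs₁ f + ∑ zs₂ f) ≡⟨ x∙yz≈y∙xz (f x) (∑ zs₁ f) (∑ zs₂ f) ⟩
      ∑ zs₁ f + (f x + ∑ zs₂ f) ≡⟨ ∑-++ zs₁ (x ∷ zs₂) f ⟨
      ∑ (zs₁ ++ x ∷ zs₂) f      ∎
      where
      open ≤-Reasoning
      xs⊆zs : xs ⊆ zs₁ ++ zs₂
      xs⊆zs p = ∈-remove zs₁ zs₂ (xs⊆ys (there p)) (λ { refl → All.lookup x∉xs p refl })

    length-⊆ : (xs ys : List A) → Unique xs → xs ⊆ ys → length xs ≤ length ys
    length-⊆ xs ys !xs xs⊆ys =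
      subst₂ _≤_ (sym (length≡∑1 xs)) (sym (length≡∑1 ys)) (∑-⊆ xs ys (λ _ → 1) !xs xs⊆ys)

    length-filter-complement : {P : Pred A 0ℓ} (P? : Decidable P) (xs : List A) →
                               length (filter P? xs) + length (filter (λ x → ¬? (P? x)) xs) ≡ length xs
    length-filter-complement P? []       = refl
    length-filter-complement P? (x ∷ xs) with P? x
    ... | yes _ = cong suc (length-filter-complement P? xs)
    ... | no _  = trans (+-suc _ _) (cong suc (length-filter-complement P? xs))

    length-filter : {P : Pred A 0ℓ} (P? : Decidable P) (xs : List A) →
                    length (filter P? xs) ≡ ∑[ x ∈ xs ] 𝟙 (P? x)
    length-filter P? []       = refl
    length-filter P? (x ∷ xs) with P? x
    ... | yes _ = cong suc (length-filter P? xs)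
    ... | no _  = length-filter P? xs

  module _ {A B : Set} where

    ∑-map : (g : A → B) (xs : List A) (f : B → ℕ) → ∑ (map g xs) f ≡ ∑[ x ∈ xs ] f (g x)
    ∑-map g []       f = refl
    ∑-map g (x ∷ xs) f = cong (f (g x) +_) (∑-map g xs f)

    ∑-concatMap : (g : A → List B) (xs : List A) (f : B → ℕ) →
                  ∑ (concatMap g xs) f ≡ ∑[ x ∈ xs ] ∑ (g x) f
    ∑-concatMap g []       f = refl
    ∑-concatMap g (x ∷ xs) f =
      trans (∑-++ (g x) (concatMap g xs) f) (cong (∑ (g x) f +_) (∑-concatMap g xs f))

    length-concatMap : (g : A → List B) (xs : List A) → length (concatMap g xs) ≡ ∑[ x ∈ xs ] length (g x)
    length-concatMap g xs = begin
      length (concatMap g xs)    ≡⟨ length≡∑1 (concatMap g xs) ⟩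
      ∑[ _ ∈ concatMap g xs ] 1  ≡⟨ ∑-concatMap g xs (λ _ → 1) ⟩
      ∑[ x ∈ xs ] ∑[ _ ∈ g x ] 1 ≡⟨ ∑-cong xs (λ x → sym (length≡∑1 (g x))) ⟩
      ∑[ x ∈ xs ] length (g x)   ∎
      where open ≡-Reasoning

    ∑-swap : (xs : List A) (ys : List B) (f : A → B → ℕ) →
             ∑[ x ∈ xs ] ∑[ y ∈ ys ] f x y ≡ ∑[ y ∈ ys ] ∑[ x ∈ xs ] f x y
    ∑-swap []       ys f = sym (∑-0 ys _ (λ _ → refl))
    ∑-swap (x ∷ xs) ys f = trans (cong (∑ ys (f x) +_) (∑-swap xs ys f))
                                 (sym (∑-+ ys (f x) (λ y → ∑[ x ∈ xs ] f x y)))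

    Unique-concatMap : (g : A → List B) (xs : List A) → Unique xs → (∀ x → Unique (g x)) →
                       (∀ x x′ {y} → y ∈ g x → y ∈ g x′ → x ≡ x′) → Unique (concatMap g xs)
    Unique-concatMap g []       _            _     _        = []
    Unique-concatMap g (x ∷ xs) (x∉xs ∷ !xs) !g disjoint =
      Unique.++⁺ (!g x) (Unique-concatMap g xs !xs !g disjoint) λ (p , q) → separate p q
      where
      separate : ∀ {y} → y ∈ g x → y ∈ concatMap g xs → ⊥
      separate p q with find (∈-concatMap⁻ g {xs = xs} q)
      ... | x′ , x′∈xs , y∈gx′ = All.lookup x∉xs x′∈xs (disjoint x x′ p y∈gx′)

  module _ {A : Set} (_≟_ : DecidableEquality A) where

    count≤1 : (xs : List A) (a : A) → Unique xs → ∑[ x ∈ xs ] 𝟙 (x ≟ a) ≤ 1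
    count≤1 xs a !xs = begin
      ∑[ x ∈ xs ] 𝟙 (x ≟ a)     ≡⟨ length-filter (_≟ a) xs ⟨
      length (filter (_≟ a) xs) ≤⟨ length-⊆ _ (a ∷ []) (Unique.filter⁺ (_≟ a) !xs) filter⊆[a] ⟩
      1                         ∎
      where
      open ≤-Reasoning
      filter⊆[a] : filter (_≟ a) xs ⊆ a ∷ []
      filter⊆[a] p = here (proj₂ (∈-filter⁻ (_≟ a) {xs = xs} p))

    count≡1 : (xs : List A) (a : A) → Unique xs → a ∈ xs → ∑[ x ∈ xs ] 𝟙 (x ≟ a) ≡ 1
    count≡1 xs a !xs a∈xs = ≤-antisym (count≤1 xs a !xs)
      (subst (_≤ ∑[ x ∈ xs ] 𝟙 (x ≟ a)) (𝟙-≡1 (a ≟ a) refl) (∈⇒≤∑ (λ x → 𝟙 (x ≟ a)) a∈xs))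

module Inequalities where

  open import Data.Nat
  open import Data.Nat.Properties
  open import Data.Nat.Tactic.RingSolver using (solve-∀)
  open import Data.Sum using (inj₁; inj₂)
  open import Relation.Binary.PropositionalEquality
  open import Algebra.Properties.CommutativeSemigroup *-commutativeSemigroup using (x∙yz≈y∙xz)
  open import Function.Base using (case_of_)
  open import Data.List.Relation.Binary.Subset.Propositional using (_⊆_)
  open import Relation.Nullary using (yes; no; contradiction)
  open import Relation.Binary.Definitions using (DecidableEquality)
  open Sums

  ^-distribʳ-* : ∀ a b k → (a * b) ^ k ≡ a ^ k * b ^ k
  ^-distribʳ-* a b zero    = refl
  ^-distribʳ-* a b (suc k) rewrite ^-distribʳ-* a b k = shuffle a b (a ^ k) (b ^ k)
    where
    shuffle : ∀ a b x y → a * b * (x * y) ≡ a * x * (b * y)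
    shuffle = solve-∀

  ∣m-n∣²+2mn≡m²+n² : ∀ m n → ∣ m - n ∣ * ∣ m - n ∣ + 2 * (m * n) ≡ m * m + n * n
  ∣m-n∣²+2mn≡m²+n² m n = case ≤-total m n of λ where
      (inj₁ m≤n) → ordered m≤n
      (inj₂ n≤m) → begin
        ∣ m - n ∣ * ∣ m - n ∣ + 2 * (m * n) ≡⟨ cong₂ (λ a b → a * a + 2 * b) (∣-∣-comm m n) (*-comm m n) ⟩
        ∣ n - m ∣ * ∣ n - m ∣ + 2 * (n * m) ≡⟨ ordered n≤m ⟩
        n * n + m * m                       ≡⟨ +-comm (n * n) (m * m) ⟩
        m * m + n * n                       ∎
    where
    open ≡-Reasoning
    shifted : ∀ a c → ∣ a - a + c ∣ * ∣ a - a + c ∣ + 2 * (a * (a + c)) ≡ a * a + (a + c) * (a + c)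
    shifted a c rewrite ∣m-m+n∣≡n a c = square c a
      where
      square : ∀ c a → c * c + 2 * (a * (a + c)) ≡ a * a + (a + c) * (a + c)
      square = solve-∀
    ordered : ∀ {a b} → a ≤ b → ∣ a - b ∣ * ∣ a - b ∣ + 2 * (a * b) ≡ a * a + b * b
    ordered {a} {b} a≤b =
      subst (λ b → ∣ a - b ∣ * ∣ a - b ∣ + 2 * (a * b) ≡ a * a + b * b) (m+[n∸m]≡n a≤b) (shifted a (b ∸ a))

  2mn≤m²+n² : ∀ m n → 2 * (m * n) ≤ m * m + n * n
  2mn≤m²+n² m n = subst (2 * (m * n) ≤_) (∣m-n∣²+2mn≡m²+n² m n) (m≤n+m (2 * (m * n)) (∣ m - n ∣ * ∣ m - n ∣))

  rearrangement : ∀ k a b → a * b ^ k + b * a ^ k ≤ a * a ^ k + b * b ^ k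
  rearrangement k a b = case ≤-total a b of λ where
      (inj₁ a≤b) → ordered a≤b
      (inj₂ b≤a) → subst₂ _≤_ (+-comm (b * a ^ k) (a * b ^ k)) (+-comm (b * b ^ k) (a * a ^ k)) (ordered b≤a)
    where
    shifted : ∀ a c → a * (a + c) ^ k + (a + c) * a ^ k ≤ a * a ^ k + (a + c) * (a + c) ^ k
    shifted a c = subst₂ _≤_ (sym (expandˡ a c (a ^ k) ((a + c) ^ k))) (sym (expandʳ a c (a ^ k) ((a + c) ^ k)))
      (+-monoʳ-≤ (a * (a + c) ^ k + a * a ^ k) (*-monoʳ-≤ c (^-monoˡ-≤ k (m≤m+n a c))))
      where
      expandˡ : ∀ a c A B → a * B + (a + c) * A ≡ (a * B + a * A) + c * A
      expandˡ = solve-∀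
      expandʳ : ∀ a c A B → a * A + (a + c) * B ≡ (a * B + a * A) + c * B
      expandʳ = solve-∀
    ordered : ∀ {a b} → a ≤ b → a * b ^ k + b * a ^ k ≤ a * a ^ k + b * b ^ k
    ordered {a} {b} a≤b =
      subst (λ b → a * b ^ k + b * a ^ k ≤ a * a ^ k + b * b ^ k) (m+[n∸m]≡n a≤b) (shifted a (b ∸ a))

  module _ {A : Set} (xs : List A) (g : A → ℕ) where

    ∑-chebyshev : ∀ k → ∑ xs g * ∑[ a ∈ xs ] (g a ^ k) ≤ length xs * ∑[ a ∈ xs ] (g a ^ suc k)
    ∑-chebyshev k = *-cancelˡ-≤ 2 (begin
      2 * (∑ xs g * ∑[ a ∈ xs ] (g a ^ k))                  ≡⟨ cong (2 *_) product ⟩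
      2 * P                                                 ≡⟨ twice P ⟩
      P + P                                                 ≡⟨ cong (P +_) (∑-swap xs xs _) ⟩
      P + ∑[ a ∈ xs ] ∑[ b ∈ xs ] (g b * g a ^ k)           ≡⟨ ∑-+ xs _ _ ⟨
      ∑[ a ∈ xs ] (P′ a + ∑[ b ∈ xs ] (g b * g a ^ k))      ≡⟨ ∑-cong xs (λ a → ∑-+ xs _ _) ⟨
      ∑[ a ∈ xs ] ∑[ b ∈ xs ] (g a * g b ^ k + g b * g a ^ k)
        ≤⟨ ∑-mono xs (λ a → ∑-mono xs (λ b → rearrangement k (g a) (g b))) ⟩
      ∑[ a ∈ xs ] ∑[ b ∈ xs ] (g a ^ suc k + g b ^ suc k)   ≡⟨ ∑-cong xs (λ a → ∑-+ xs _ _) ⟩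
      ∑[ a ∈ xs ] (∑[ _ ∈ xs ] (g a ^ suc k) + R)           ≡⟨ ∑-+ xs _ _ ⟩
      ∑[ a ∈ xs ] ∑[ _ ∈ xs ] (g a ^ suc k) + ∑[ _ ∈ xs ] R ≡⟨ cong₂ _+_ constant (∑-const xs R) ⟩
      length xs * R + length xs * R                         ≡⟨ twice (length xs * R) ⟨
      2 * (length xs * R)                                   ∎)
      where
      open ≤-Reasoning
      P′ : A → ℕ
      P′ a = ∑[ b ∈ xs ] (g a * g b ^ k)
      P R : ℕ
      P = ∑ xs P′
      R = ∑[ a ∈ xs ] (g a ^ suc k)
      twice : ∀ x → 2 * x ≡ x + x
      twice = solve-∀
      product : ∑ xs g * ∑[ a ∈ xs ] (g a ^ k) ≡ P
      product = trans (sym (∑-*ʳ _ xs g)) (∑-cong xs (λ a → sym (∑-*ˡ (g a) xs (λ b → g b ^ k))))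
      constant : ∑[ a ∈ xs ] ∑[ _ ∈ xs ] (g a ^ suc k) ≡ length xs * R
      constant = trans (∑-cong xs (λ a → ∑-const xs (g a ^ suc k))) (∑-*ˡ (length xs) xs _)

    ∑-power-mean : ∀ k → ∑ xs g ^ suc k ≤ length xs ^ k * ∑[ a ∈ xs ] (g a ^ suc k)
    ∑-power-mean zero = ≤-reflexive (begin-equality
      ∑ xs g * 1                ≡⟨ *-identityʳ _ ⟩
      ∑ xs g                    ≡⟨ ∑-cong xs (λ a → sym (*-identityʳ (g a))) ⟩
      ∑[ a ∈ xs ] (g a ^ 1)     ≡⟨ +-identityʳ _ ⟨
      1 * ∑[ a ∈ xs ] (g a ^ 1) ∎)
      where open ≤-Reasoning
    ∑-power-mean (suc k) = begin
      S * S ^ suc k                                 ≤⟨ *-monoʳ-≤ S (∑-power-mean k) ⟩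
      S * (L ^ k * ∑[ a ∈ xs ] (g a ^ suc k))       ≡⟨ x∙yz≈y∙xz S (L ^ k) _ ⟩
      L ^ k * (S * ∑[ a ∈ xs ] (g a ^ suc k))       ≤⟨ *-monoʳ-≤ (L ^ k) (∑-chebyshev (suc k)) ⟩
      L ^ k * (L * ∑[ a ∈ xs ] (g a ^ suc (suc k))) ≡⟨ x∙yz≈y∙xz (L ^ k) L _ ⟩
      L * (L ^ k * ∑[ a ∈ xs ] (g a ^ suc (suc k))) ≡⟨ *-assoc L (L ^ k) _ ⟨
      L * L ^ k * ∑[ a ∈ xs ] (g a ^ suc (suc k))   ∎
      where
      open ≤-Reasoning
      S = ∑ xs g
      L = length xs

  bernoulli : ∀ x c k → (x + c) ^ suc k ≤ (x + c) * x ^ k + k * c * (x + c) ^ k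
  bernoulli x c zero    = ≤-reflexive (sym (+-identityʳ _))
  bernoulli x c (suc k) = begin
    (x + c) * (x + c) ^ suc k                                           ≤⟨ *-monoʳ-≤ (x + c) (bernoulli x c k) ⟩
    (x + c) * ((x + c) * x ^ k + k * c * (x + c) ^ k)                   ≡⟨ expand x c (x ^ k) ((x + c) ^ k) k ⟩
    (x + c) * x ^ suc k + c * ((x + c) * x ^ k) + k * c * (x + c) ^ suc k
      ≤⟨ +-monoˡ-≤ (k * c * (x + c) ^ suc k) (+-monoʳ-≤ ((x + c) * x ^ suc k) (*-monoʳ-≤ c [x+c]*x^k≤[x+c]^[k+1])) ⟩
    (x + c) * x ^ suc k + c * (x + c) ^ suc k + k * c * (x + c) ^ suc k ≡⟨ collect x c (x ^ suc k) ((x + c) ^ suc k) k ⟩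
    (x + c) * x ^ suc k + suc k * c * (x + c) ^ suc k                   ∎
    where
    open ≤-Reasoning
    expand : ∀ x c A B k → (x + c) * ((x + c) * A + k * c * B) ≡ (x + c) * (x * A) + c * ((x + c) * A) + k * c * ((x + c) * B)
    expand = solve-∀
    collect : ∀ x c A B k → (x + c) * A + c * B + k * c * B ≡ (x + c) * A + (1 + k) * c * B
    collect = solve-∀
    [x+c]*x^k≤[x+c]^[k+1] : (x + c) * x ^ k ≤ (x + c) ^ suc k
    [x+c]*x^k≤[x+c]^[k+1] = *-monoʳ-≤ (x + c) (^-monoˡ-≤ k (m≤m+n x c))

  -- In the next three lemmas d = suc e, so that suc (e + e) = 2d − 1.
  [2d]^d≤2*[2d-1]^d : ∀ e → suc (suc (e + e)) ^ suc e ≤ 2 * suc (e + e) ^ suc e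
  [2d]^d≤2*[2d-1]^d e = *-cancelˡ-≤ d (+-cancelʳ-≤ (d * b ^ d) (d * b ^ d) (d * (2 * a ^ d)) (begin
    d * b ^ d + d * b ^ d       ≡⟨ double e (b ^ d) ⟩
    b * b ^ d                   ≤⟨ subst (λ z → z ^ suc d ≤ z * a ^ d + d * 1 * z ^ d) (+-comm a 1) (bernoulli a 1 d) ⟩
    b * a ^ d + d * 1 * b ^ d   ≡⟨ regroup e (a ^ d) (b ^ d) ⟩
    d * (2 * a ^ d) + d * b ^ d ∎))
    where
    open ≤-Reasoning
    d a b : ℕ
    d = suc e
    a = suc (e + e)
    b = suc a
    double : ∀ e X → suc e * X + suc e * X ≡ suc (suc (e + e)) * X
    double = solve-∀
    regroup : ∀ e Y X → suc (suc (e + e)) * Y + suc e * 1 * X ≡ suc e * (2 * Y) + suc e * X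
    regroup = solve-∀

  [n²]^d≤2*H^d : ∀ e n H → suc (e + e) * (n * n) ≤ suc (suc (e + e)) * H → (n * n) ^ suc e ≤ 2 * H ^ suc e
  [n²]^d≤2*H^d e n H n²≲H = *-cancelˡ-≤ (a ^ d) {{m^n≢0 a d}} (begin
    a ^ d * (n * n) ^ d ≡⟨ ^-distribʳ-* a (n * n) d ⟨
    (a * (n * n)) ^ d   ≤⟨ ^-monoˡ-≤ d n²≲H ⟩
    (suc a * H) ^ d     ≡⟨ ^-distribʳ-* (suc a) H d ⟩
    suc a ^ d * H ^ d   ≤⟨ *-monoˡ-≤ (H ^ d) ([2d]^d≤2*[2d-1]^d e) ⟩
    2 * a ^ d * H ^ d   ≡⟨ cong (_* H ^ d) (*-comm 2 (a ^ d)) ⟩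
    a ^ d * 2 * H ^ d   ≡⟨ *-assoc (a ^ d) 2 (H ^ d) ⟩
    a ^ d * (2 * H ^ d) ∎)
    where
    open ≤-Reasoning
    d a : ℕ
    d = suc e
    a = suc (e + e)

  n^[d+1]≤3QN : ∀ e n N H Q → H ^ suc e ≤ Q * n ^ e * N → suc (e + e) * (n * n) ≤ suc (suc (e + e)) * H →
                n ^ (suc e + 1) ≤ 3 * Q * N
  n^[d+1]≤3QN e zero        N H Q _         _           = z≤n
  n^[d+1]≤3QN e n@(suc _) N H Q H^d≤Qn^eN n²≲H =
    *-cancelʳ-≤ (n ^ (suc e + 1)) (3 * Q * N) (n ^ e) {{m^n≢0 n e}} (begin
      n ^ (suc e + 1) * n ^ e ≡⟨ ^-distribˡ-+-* n (suc e + 1) e ⟨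
      n ^ (suc e + 1 + e)     ≡⟨ cong (n ^_) (exponent e) ⟩
      n ^ (suc e + suc e)     ≡⟨ ^-distribˡ-+-* n (suc e) (suc e) ⟩
      n ^ suc e * n ^ suc e   ≡⟨ ^-distribʳ-* n n (suc e) ⟨
      (n * n) ^ suc e         ≤⟨ [n²]^d≤2*H^d e n H n²≲H ⟩
      2 * H ^ suc e           ≤⟨ *-mono-≤ (m≤n+m 2 1) H^d≤Qn^eN ⟩
      3 * (Q * n ^ e * N)     ≡⟨ regroup Q (n ^ e) N ⟩
      3 * Q * N * n ^ e       ∎)
    where
    open ≤-Reasoning
    exponent : ∀ e → suc e + 1 + e ≡ suc e + suc e
    exponent = solve-∀
    regroup : ∀ Q X N → 3 * (Q * X * N) ≡ 3 * Q * N * X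
    regroup = solve-∀

  m^k≤n^k⇒m≤n : ∀ k .{{_ : NonZero k}} {m n} → m ^ k ≤ n ^ k → m ≤ n
  m^k≤n^k⇒m≤n k {m} {n} m^k≤n^k with m ≤? n
  ... | yes m≤n = m≤n
  ... | no  m≰n = contradiction m^k≤n^k (<⇒≱ (^-monoˡ-< k (≰⇒> m≰n)))

  -- Every y ∈ E is incident (i y x) with ν y · Q/q of the Q points of V, and distinct y, y′ share
  -- at most ν y · ν y′ · Q/q² of them; the counts h x then concentrate around m/q.
  module SecondMoment
    {P X : Set} (_≟_ : DecidableEquality P) (E : List P) (!E : Unique E) (V : List X)
    (q Q : ℕ) (|V|≡Q : length V ≡ Q) (ν : P → ℕ) (i : P → X → ℕ)
    (first-moment : ∀ y → q * ∑ V (i y) ≡ ν y * Q)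
    (second-moment : ∀ y y′ → q * (q * ∑[ x ∈ V ] (i y x * i y′ x)) ≤ 𝟙 (y′ ≟ y) * (ν y * (q * Q)) + ν y * ν y′ * Q)
    where

    h : X → ℕ
    h x = ∑[ y ∈ E ] i y x

    m : ℕ
    m = ∑ E ν

    q∑h≡mQ : q * ∑ V h ≡ m * Q
    q∑h≡mQ = begin
      q * ∑ V h                  ≡⟨ cong (q *_) (∑-swap V E (λ x y → i y x)) ⟩
      q * (∑[ y ∈ E ] ∑ V (i y)) ≡⟨ ∑-*ˡ q E (λ y → ∑ V (i y)) ⟨
      ∑[ y ∈ E ] (q * ∑ V (i y)) ≡⟨ ∑-cong E first-moment ⟩
      ∑[ y ∈ E ] (ν y * Q)       ≡⟨ ∑-*ʳ Q E ν ⟩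
      m * Q                      ∎
      where open ≡-Reasoning

    ∑h²≡∑∑pairs : ∑[ x ∈ V ] (h x * h x) ≡ ∑[ y ∈ E ] ∑[ y′ ∈ E ] ∑[ x ∈ V ] (i y x * i y′ x)
    ∑h²≡∑∑pairs = begin
      ∑[ x ∈ V ] (h x * h x)                             ≡⟨ ∑-cong V expand ⟩
      ∑[ x ∈ V ] ∑[ y ∈ E ] ∑[ y′ ∈ E ] (i y x * i y′ x) ≡⟨ ∑-swap V E _ ⟩
      ∑[ y ∈ E ] ∑[ x ∈ V ] ∑[ y′ ∈ E ] (i y x * i y′ x) ≡⟨ ∑-cong E (λ y → ∑-swap V E _) ⟩
      ∑[ y ∈ E ] ∑[ y′ ∈ E ] ∑[ x ∈ V ] (i y x * i y′ x) ∎
      where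
      open ≡-Reasoning
      expand : ∀ x → h x * h x ≡ ∑[ y ∈ E ] ∑[ y′ ∈ E ] (i y x * i y′ x)
      expand x = trans (sym (∑-*ʳ (h x) E (λ y → i y x))) (∑-cong E (λ y → sym (∑-*ˡ (i y x) E (λ y′ → i y′ x))))

    q²∑h²≤mqQ+m²Q : q * (q * ∑[ x ∈ V ] (h x * h x)) ≤ m * (q * Q) + m * (m * Q)
    q²∑h²≤mqQ+m²Q = begin
      q * (q * ∑[ x ∈ V ] (h x * h x))                                       ≡⟨ cong (λ s → q * (q * s)) ∑h²≡∑∑pairs ⟩
      q * (q * ∑[ y ∈ E ] ∑[ y′ ∈ E ] pair y y′)                             ≡⟨ pull-in ⟩
      ∑[ y ∈ E ] ∑[ y′ ∈ E ] (q * (q * pair y y′))                           ≤⟨ ∑-mono E (λ y → ∑-mono E (second-moment y)) ⟩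
      ∑[ y ∈ E ] ∑[ y′ ∈ E ] (𝟙 (y′ ≟ y) * (ν y * (q * Q)) + ν y * ν y′ * Q) ≤⟨ ∑-mono E row ⟩
      ∑[ y ∈ E ] (ν y * (q * Q) + ν y * (m * Q))                             ≡⟨ ∑-+ E _ _ ⟩
      ∑[ y ∈ E ] (ν y * (q * Q)) + ∑[ y ∈ E ] (ν y * (m * Q))                ≡⟨ cong₂ _+_ (∑-*ʳ _ E ν) (∑-*ʳ _ E ν) ⟩
      m * (q * Q) + m * (m * Q)                                              ∎
      where
      open ≤-Reasoning
      pair : P → P → ℕ
      pair y y′ = ∑[ x ∈ V ] (i y x * i y′ x)
      pull-in : q * (q * ∑[ y ∈ E ] ∑[ y′ ∈ E ] pair y y′) ≡ ∑[ y ∈ E ] ∑[ y′ ∈ E ] (q * (q * pair y y′))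
      pull-in = begin-equality
        q * (q * ∑[ y ∈ E ] ∑[ y′ ∈ E ] pair y y′)   ≡⟨ cong (q *_) (∑-*ˡ q E _) ⟨
        q * ∑[ y ∈ E ] (q * ∑[ y′ ∈ E ] pair y y′)   ≡⟨ ∑-*ˡ q E _ ⟨
        ∑[ y ∈ E ] (q * (q * ∑[ y′ ∈ E ] pair y y′)) ≡⟨ ∑-cong E (λ y → trans (cong (q *_) (sym (∑-*ˡ q E _))) (sym (∑-*ˡ q E _))) ⟩
        ∑[ y ∈ E ] ∑[ y′ ∈ E ] (q * (q * pair y y′)) ∎
      row : ∀ y → ∑[ y′ ∈ E ] (𝟙 (y′ ≟ y) * (ν y * (q * Q)) + ν y * ν y′ * Q) ≤ ν y * (q * Q) + ν y * (m * Q)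
      row y = begin
        ∑[ y′ ∈ E ] (𝟙 (y′ ≟ y) * (ν y * (q * Q)) + ν y * ν y′ * Q)
          ≡⟨ ∑-+ E _ _ ⟩
        ∑[ y′ ∈ E ] (𝟙 (y′ ≟ y) * (ν y * (q * Q))) + ∑[ y′ ∈ E ] (ν y * ν y′ * Q)
          ≡⟨ cong₂ _+_ (∑-*ʳ _ E (λ y′ → 𝟙 (y′ ≟ y))) factor ⟩
        ∑[ y′ ∈ E ] 𝟙 (y′ ≟ y) * (ν y * (q * Q)) + ν y * (m * Q)
          ≤⟨ +-monoˡ-≤ _ (*-monoˡ-≤ _ (count≤1 _≟_ E y !E)) ⟩
        1 * (ν y * (q * Q)) + ν y * (m * Q)
          ≡⟨ cong (_+ ν y * (m * Q)) (*-identityˡ _) ⟩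
        ν y * (q * Q) + ν y * (m * Q) ∎
        where
        factor : ∑[ y′ ∈ E ] (ν y * ν y′ * Q) ≡ ν y * (m * Q)
        factor = trans (∑-cong E (λ y′ → *-assoc (ν y) (ν y′) Q)) (trans (∑-*ˡ (ν y) E _) (cong (ν y *_) (∑-*ʳ Q E ν)))

    variance : ∑[ x ∈ V ] (∣ m - q * h x ∣ * ∣ m - q * h x ∣) ≤ m * (q * Q)
    variance = +-cancelʳ-≤ (2 * m * (m * Q)) D (m * (q * Q)) (begin
      D + 2 * m * (m * Q)                            ≡⟨ expand ⟩
      q * (q * ∑[ x ∈ V ] (h x * h x)) + Q * (m * m) ≤⟨ +-monoˡ-≤ (Q * (m * m)) q²∑h²≤mqQ+m²Q ⟩
      m * (q * Q) + m * (m * Q) + Q * (m * m)        ≡⟨ collect (m * (q * Q)) m Q ⟩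
      m * (q * Q) + 2 * m * (m * Q)                  ∎)
      where
      open ≤-Reasoning
      D : ℕ
      D = ∑[ x ∈ V ] (∣ m - q * h x ∣ * ∣ m - q * h x ∣)
      collect : ∀ a m Q → a + m * (m * Q) + Q * (m * m) ≡ a + 2 * m * (m * Q)
      collect = solve-∀
      rearrange : ∀ m qh → ∣ m - qh ∣ * ∣ m - qh ∣ + 2 * m * qh ≡ qh * qh + m * m
      rearrange m qh = begin-equality
        ∣ m - qh ∣ * ∣ m - qh ∣ + 2 * m * qh   ≡⟨ cong (∣ m - qh ∣ * ∣ m - qh ∣ +_) (*-assoc 2 m qh) ⟩
        ∣ m - qh ∣ * ∣ m - qh ∣ + 2 * (m * qh) ≡⟨ ∣m-n∣²+2mn≡m²+n² m qh ⟩
        m * m + qh * qh                        ≡⟨ +-comm (m * m) (qh * qh) ⟩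
        qh * qh + m * m                        ∎
      square : ∀ q h → q * h * (q * h) ≡ q * (q * (h * h))
      square = solve-∀
      expand : D + 2 * m * (m * Q) ≡ q * (q * ∑[ x ∈ V ] (h x * h x)) + Q * (m * m)
      expand = begin-equality
        D + 2 * m * (m * Q)
          ≡⟨ cong (λ s → D + 2 * m * s) q∑h≡mQ ⟨
        D + 2 * m * (q * ∑ V h)
          ≡⟨ cong (D +_) (trans (∑-*ˡ (2 * m) V _) (cong (2 * m *_) (∑-*ˡ q V h))) ⟨
        D + ∑[ x ∈ V ] (2 * m * (q * h x))
          ≡⟨ ∑-+ V _ _ ⟨
        ∑[ x ∈ V ] (∣ m - q * h x ∣ * ∣ m - q * h x ∣ + 2 * m * (q * h x))
          ≡⟨ ∑-cong V (λ x → rearrange m (q * h x)) ⟩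
        ∑[ x ∈ V ] (q * h x * (q * h x) + m * m)
          ≡⟨ ∑-+ V _ _ ⟩
        ∑[ x ∈ V ] (q * h x * (q * h x)) + ∑[ _ ∈ V ] (m * m)
          ≡⟨ cong₂ _+_ (∑-cong V (λ x → square q (h x))) (∑-const V (m * m)) ⟩
        ∑[ x ∈ V ] (q * (q * (h x * h x))) + length V * (m * m)
          ≡⟨ cong₂ _+_ (trans (∑-*ˡ q V _) (cong (q *_) (∑-*ˡ q V _))) (cong (_* (m * m)) |V|≡Q) ⟩
        q * (q * ∑[ x ∈ V ] (h x * h x)) + Q * (m * m) ∎

    deviation : (W : List X) → Unique W → W ⊆ V → ∀ M →
                2 * (M * (length W * m ∸ q * ∑ W h)) ≤ m * (q * Q) + length W * (M * M)
    deviation W !W W⊆V M = begin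
      2 * (M * (length W * m ∸ q * ∑ W h)) ≤⟨ *-monoʳ-≤ 2 (*-monoʳ-≤ M pointwise) ⟩
      2 * (M * ∑[ x ∈ W ] (m ∸ q * h x))   ≡⟨ trans (∑-*ˡ 2 W _) (cong (2 *_) (∑-*ˡ M W _)) ⟨
      ∑[ x ∈ W ] (2 * (M * (m ∸ q * h x))) ≤⟨ ∑-mono W (λ x → amgm (m ∸ q * h x) (m∸n≤∣m-n∣ m (q * h x))) ⟩
      ∑[ x ∈ W ] (M * M + ∣ m - q * h x ∣ * ∣ m - q * h x ∣)
        ≡⟨ trans (∑-+ W _ _) (cong (_+ ∑[ x ∈ W ] (∣ m - q * h x ∣ * ∣ m - q * h x ∣)) (∑-const W (M * M))) ⟩
      length W * (M * M) + ∑[ x ∈ W ] (∣ m - q * h x ∣ * ∣ m - q * h x ∣)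
        ≤⟨ +-monoʳ-≤ (length W * (M * M)) (∑-⊆ W V _ !W W⊆V) ⟩
      length W * (M * M) + ∑[ x ∈ V ] (∣ m - q * h x ∣ * ∣ m - q * h x ∣)
        ≤⟨ +-monoʳ-≤ (length W * (M * M)) variance ⟩
      length W * (M * M) + m * (q * Q)     ≡⟨ +-comm (length W * (M * M)) _ ⟩
      m * (q * Q) + length W * (M * M)     ∎
      where
      open ≤-Reasoning
      pointwise : length W * m ∸ q * ∑ W h ≤ ∑[ x ∈ W ] (m ∸ q * h x)
      pointwise = subst₂ (λ a b → a ∸ b ≤ ∑[ x ∈ W ] (m ∸ q * h x)) (∑-const W m) (∑-*ˡ q W h) (∑-∸ W (λ _ → m) (λ x → q * h x))
      amgm : ∀ a {b} → a ≤ b → 2 * (M * a) ≤ M * M + b * b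
      amgm a a≤b = ≤-trans (2mn≤m²+n² M a) (+-monoʳ-≤ (M * M) (*-mono-≤ a≤b a≤b))

module FieldAlgebra (F : FiniteField) where

  open import Level using (0ℓ)
  open import Algebra.Bundles using (CommutativeRing)
  import Algebra.Properties.Ring as RingProperties
  import Algebra.Properties.CommutativeSemigroup as CommutativeSemigroupProperties
  open import Data.Nat as ℕ using (ℕ; zero; suc)
  import Data.Nat.Properties as ℕ
  open import Data.List using ([]; _∷_; map; concatMap; filter)
  open import Data.List.Properties using (length-map)
  open import Data.List.Membership.Propositional using (_∉_; find)
  open import Data.List.Membership.Propositional.Properties using (∈-map⁺; ∈-map⁻; ∈-concatMap⁺; ∈-concatMap⁻; ∈-filter⁻)
  open import Data.List.Relation.Unary.Any as Any using (any?)
  import Data.List.Relation.Unary.All as ListAll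
  open import Data.List.Relation.Unary.AllPairs using ([]; _∷_)
  import Data.List.Relation.Unary.Unique.Propositional.Properties as Unique
  open import Data.Vec as Vec using (Vec; []; _∷_; replicate; foldr)
  import Data.Vec.Properties as Vecₚ
  open import Data.Vec.Relation.Unary.All using (All; []; _∷_)
  open import Data.Product using (proj₁; proj₂)
  open import Data.Empty using (⊥-elim)
  open import Relation.Binary.Definitions using (DecidableEquality)
  open import Relation.Nullary using (yes; no; ¬?)
  open import Relation.Binary.PropositionalEquality
  open Sums

  open FiniteField F

  commutativeRing : CommutativeRing 0ℓ 0ℓ
  commutativeRing = record { isCommutativeRing = isCommutativeRing }

  module R = CommutativeRing commutativeRing
  open RingProperties R.ring
    using (-‿distribˡ-*; -‿distribʳ-*; -‿involutive; -‿+-comm; x∙y⁻¹≈ε⇒x≈y; +-inverseˡ-unique; +-cancelʳ)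
  open CommutativeSemigroupProperties R.+-commutativeSemigroup using (interchange)

  -- FiniteField._≟_ has no fixity declaration, so it would bind tighter than _+_.
  infix 4 _≟ᶠ_
  _≟ᶠ_ : DecidableEquality Carrier
  _≟ᶠ_ = _≟_

  q : ℕ
  q = order

  q-nonZero : ℕ.NonZero q
  q-nonZero with elements | complete 0#
  ... | _ ∷ _ | _ = _

  _⁻¹⟨_⟩ : (a : Carrier) → a ≢ 0# → Carrier
  a ⁻¹⟨ a≢0 ⟩ = proj₁ (inverse a a≢0)

  *-inverseʳ : ∀ a (a≢0 : a ≢ 0#) → a * a ⁻¹⟨ a≢0 ⟩ ≡ 1#
  *-inverseʳ a a≢0 = proj₂ (inverse a a≢0)

  *-inverseˡ : ∀ a (a≢0 : a ≢ 0#) → a ⁻¹⟨ a≢0 ⟩ * a ≡ 1#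
  *-inverseˡ a a≢0 = trans (R.*-comm _ a) (*-inverseʳ a a≢0)

  b*a⁻¹*a≡b : ∀ a b (a≢0 : a ≢ 0#) → b * a ⁻¹⟨ a≢0 ⟩ * a ≡ b
  b*a⁻¹*a≡b a b a≢0 = trans (R.*-assoc b _ a) (trans (cong (b *_) (*-inverseˡ a a≢0)) (R.*-identityʳ b))

  *-cancelˡ : ∀ a {b c} → a ≢ 0# → a * b ≡ a * c → b ≡ c
  *-cancelˡ a {b} {c} a≢0 ab≡ac = begin
    b                     ≡⟨ R.*-identityˡ b ⟨
    1# * b                ≡⟨ cong (_* b) (*-inverseˡ a a≢0) ⟨
    (a ⁻¹⟨ a≢0 ⟩ * a) * b ≡⟨ R.*-assoc _ a b ⟩
    a ⁻¹⟨ a≢0 ⟩ * (a * b) ≡⟨ cong (a ⁻¹⟨ a≢0 ⟩ *_) ab≡ac ⟩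
    a ⁻¹⟨ a≢0 ⟩ * (a * c) ≡⟨ R.*-assoc _ a c ⟨
    (a ⁻¹⟨ a≢0 ⟩ * a) * c ≡⟨ cong (_* c) (*-inverseˡ a a≢0) ⟩
    1# * c                ≡⟨ R.*-identityˡ c ⟩
    c                     ∎
    where open ≡-Reasoning

  a*b≡0⇒b≡0 : ∀ a {b} → a ≢ 0# → a * b ≡ 0# → b ≡ 0#
  a*b≡0⇒b≡0 a a≢0 ab≡0 = *-cancelˡ a a≢0 (trans ab≡0 (sym (R.zeroʳ a)))

  a+b≡c⇒a≡c-b : ∀ {a b c} → a + b ≡ c → a ≡ c + - b
  a+b≡c⇒a≡c-b {a} {b} {c} a+b≡c = begin
    a             ≡⟨ R.+-identityʳ a ⟨
    a + 0#        ≡⟨ cong (a +_) (R.-‿inverseʳ b) ⟨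
    a + (b + - b) ≡⟨ R.+-assoc a b (- b) ⟨
    (a + b) + - b ≡⟨ cong (_+ - b) a+b≡c ⟩
    c + - b       ∎
    where open ≡-Reasoning

  -a*-b≡a*b : ∀ a b → (- a) * (- b) ≡ a * b
  -a*-b≡a*b a b = begin
    (- a) * (- b) ≡⟨ -‿distribˡ-* a (- b) ⟨
    - (a * - b)   ≡⟨ cong -_ (-‿distribʳ-* a b) ⟨
    - - (a * b)   ≡⟨ -‿involutive (a * b) ⟩
    a * b         ∎
    where open ≡-Reasoning

  linear-solution : (a r s : Carrier) → a ≢ 0# → Carrier
  linear-solution a r s a≢0 = a ⁻¹⟨ a≢0 ⟩ * (s + - r)

  linear-solution-unique : ∀ a r s (a≢0 : a ≢ 0#) z → a * z + r ≡ s → z ≡ linear-solution a r s a≢0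
  linear-solution-unique a r s a≢0 z az+r≡s = *-cancelˡ a a≢0 (begin
    a * z                         ≡⟨ a+b≡c⇒a≡c-b az+r≡s ⟩
    s + - r                       ≡⟨ R.*-identityˡ _ ⟨
    1# * (s + - r)                ≡⟨ cong (_* (s + - r)) (*-inverseʳ a a≢0) ⟨
    (a * a ⁻¹⟨ a≢0 ⟩) * (s + - r) ≡⟨ R.*-assoc a _ _ ⟩
    a * linear-solution a r s a≢0 ∎)
    where open ≡-Reasoning

  linear-solution-solves : ∀ a r s (a≢0 : a ≢ 0#) → a * linear-solution a r s a≢0 + r ≡ s
  linear-solution-solves a r s a≢0 = begin
    a * (a ⁻¹⟨ a≢0 ⟩ * (s + - r)) + r ≡⟨ cong (_+ r) (R.*-assoc a _ _) ⟨
    (a * a ⁻¹⟨ a≢0 ⟩) * (s + - r) + r ≡⟨ cong (λ w → w * (s + - r) + r) (*-inverseʳ a a≢0) ⟩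
    1# * (s + - r) + r                ≡⟨ cong (_+ r) (R.*-identityˡ _) ⟩
    (s + - r) + r                     ≡⟨ R.+-assoc s (- r) r ⟩
    s + (- r + r)                     ≡⟨ cong (s +_) (R.-‿inverseˡ r) ⟩
    s + 0#                            ≡⟨ R.+-identityʳ s ⟩
    s                                 ∎
    where open ≡-Reasoning

  count-linear : ∀ a r s → a ≢ 0# → ∑[ z ∈ elements ] 𝟙 (a * z + r ≟ᶠ s) ≡ 1
  count-linear a r s a≢0 = trans
    (∑-cong elements (λ z → 𝟙-cong (a * z + r ≟ᶠ s) (z ≟ᶠ z₀)
      (linear-solution-unique a r s a≢0 z) (λ { refl → linear-solution-solves a r s a≢0 })))
    (count≡1 _≟_ elements z₀ unique (complete z₀))
    where
    z₀ = linear-solution a r s a≢0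

  infixl 8 _∙_
  infixr 7 _·_
  infixl 6 _⊕_

  _∙_ : ∀ {k} → Pt F k → Pt F k → Carrier
  y ∙ x = dot F y x

  _·_ : ∀ {k} → Carrier → Pt F k → Pt F k
  c · x = _·ₛ_ F c x

  _⊕_ : ∀ {k} → Pt F k → Pt F k → Pt F k
  u ⊕ v = _+ᵥ_ F u v

  𝟎 : ∀ {k} → Pt F k
  𝟎 {k} = replicate k 0#

  ∙-comm : ∀ {k} (y x : Pt F k) → y ∙ x ≡ x ∙ y
  ∙-comm []      []      = refl
  ∙-comm (a ∷ y) (b ∷ x) = cong₂ _+_ (R.*-comm a b) (∙-comm y x)

  ∙-𝟎 : ∀ {k} (y : Pt F k) → y ∙ 𝟎 ≡ 0#
  ∙-𝟎 []      = refl
  ∙-𝟎 (a ∷ y) = trans (cong₂ _+_ (R.zeroʳ a) (∙-𝟎 y)) (R.+-identityˡ 0#)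

  𝟎-∙ : ∀ {k} (x : Pt F k) → 𝟎 ∙ x ≡ 0#
  𝟎-∙ x = trans (∙-comm 𝟎 x) (∙-𝟎 x)

  ∙-distribˡ-⊕ : ∀ {k} (y u v : Pt F k) → y ∙ (u ⊕ v) ≡ y ∙ u + y ∙ v
  ∙-distribˡ-⊕ []      []      []      = sym (R.+-identityʳ 0#)
  ∙-distribˡ-⊕ (a ∷ y) (b ∷ u) (c ∷ v) = begin
    a * (b + c) + y ∙ (u ⊕ v)         ≡⟨ cong₂ _+_ (R.distribˡ a b c) (∙-distribˡ-⊕ y u v) ⟩
    (a * b + a * c) + (y ∙ u + y ∙ v) ≡⟨ interchange _ _ _ _ ⟩
    (a * b + y ∙ u) + (a * c + y ∙ v) ∎
    where open ≡-Reasoning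

  ∙-distribʳ-⊕ : ∀ {k} (u v x : Pt F k) → (u ⊕ v) ∙ x ≡ u ∙ x + v ∙ x
  ∙-distribʳ-⊕ u v x = begin
    (u ⊕ v) ∙ x   ≡⟨ ∙-comm (u ⊕ v) x ⟩
    x ∙ (u ⊕ v)   ≡⟨ ∙-distribˡ-⊕ x u v ⟩
    x ∙ u + x ∙ v ≡⟨ cong₂ _+_ (∙-comm x u) (∙-comm x v) ⟩
    u ∙ x + v ∙ x ∎
    where open ≡-Reasoning

  ∙-·ˡ : ∀ {k} c (y x : Pt F k) → (c · y) ∙ x ≡ c * (y ∙ x)
  ∙-·ˡ c []      []      = sym (R.zeroʳ c)
  ∙-·ˡ c (a ∷ y) (b ∷ x) = begin
    (c * a) * b + (c · y) ∙ x ≡⟨ cong₂ _+_ (R.*-assoc c a b) (∙-·ˡ c y x) ⟩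
    c * (a * b) + c * (y ∙ x) ≡⟨ R.distribˡ c _ _ ⟨
    c * (a * b + y ∙ x)       ∎
    where open ≡-Reasoning

  ∙-·ʳ : ∀ {k} c (y x : Pt F k) → y ∙ (c · x) ≡ c * (y ∙ x)
  ∙-·ʳ c y x = trans (∙-comm y (c · x)) (trans (∙-·ˡ c x y) (cong (c *_) (∙-comm x y)))

  ·-identityˡ : ∀ {k} (y : Pt F k) → 1# · y ≡ y
  ·-identityˡ []      = refl
  ·-identityˡ (a ∷ y) = cong₂ _∷_ (R.*-identityˡ a) (·-identityˡ y)

  0·x⊕v≡v : ∀ {k} (x v : Pt F k) → 0# · x ⊕ v ≡ v
  0·x⊕v≡v []      []      = refl
  0·x⊕v≡v (a ∷ x) (b ∷ v) = cong₂ _∷_ (trans (cong (_+ b) (R.zeroˡ a)) (R.+-identityˡ b)) (0·x⊕v≡v x v)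

  ·-assoc : ∀ {k} a b (x : Pt F k) → a · b · x ≡ (a * b) · x
  ·-assoc a b []      = refl
  ·-assoc a b (z ∷ x) = cong₂ _∷_ (sym (R.*-assoc a b z)) (·-assoc a b x)

  ·-distrib-⊕ : ∀ {k} a (u v : Pt F k) → a · (u ⊕ v) ≡ a · u ⊕ a · v
  ·-distrib-⊕ a []      []      = refl
  ·-distrib-⊕ a (b ∷ u) (c ∷ v) = cong₂ _∷_ (R.distribˡ a b c) (·-distrib-⊕ a u v)

  ·-𝟎 : ∀ {k} a → a · 𝟎 {k} ≡ 𝟎
  ·-𝟎 {zero}  a = refl
  ·-𝟎 {suc k} a = cong₂ _∷_ (R.zeroʳ a) (·-𝟎 a)

  u⊕-c·v≡𝟎⇒u≡c·v : ∀ {k} c (u v : Pt F k) → u ⊕ (- c) · v ≡ 𝟎 → u ≡ c · v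
  u⊕-c·v≡𝟎⇒u≡c·v c []      []      _  = refl
  u⊕-c·v≡𝟎⇒u≡c·v c (a ∷ u) (b ∷ v) eq = cong₂ _∷_
    (x∙y⁻¹≈ε⇒x≈y a (c * b) (trans (cong (a +_) (-‿distribˡ-* c b)) (Vecₚ.∷-injectiveˡ eq)))
    (u⊕-c·v≡𝟎⇒u≡c·v c u v (Vecₚ.∷-injectiveʳ eq))

  solve-for : ∀ {k} c (c≢0 : c ≢ 0#) (x v : Pt F k) → c · x ⊕ v ≡ 𝟎 → x ≡ (- (c ⁻¹⟨ c≢0 ⟩)) · v
  solve-for c c≢0 []      []      _  = refl
  solve-for c c≢0 (a ∷ x) (b ∷ v) eq = cong₂ _∷_ head (solve-for c c≢0 x v (Vecₚ.∷-injectiveʳ eq))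
    where
    head : a ≡ (- (c ⁻¹⟨ c≢0 ⟩)) * b
    head = begin
      a                     ≡⟨ R.*-identityˡ a ⟨
      1# * a                ≡⟨ cong (_* a) (*-inverseˡ c c≢0) ⟨
      (c ⁻¹⟨ c≢0 ⟩ * c) * a ≡⟨ R.*-assoc _ c a ⟩
      c ⁻¹⟨ c≢0 ⟩ * (c * a) ≡⟨ cong (c ⁻¹⟨ c≢0 ⟩ *_) (+-inverseˡ-unique (c * a) b (Vecₚ.∷-injectiveˡ eq)) ⟩
      c ⁻¹⟨ c≢0 ⟩ * (- b)   ≡⟨ -‿distribʳ-* _ b ⟨
      - (c ⁻¹⟨ c≢0 ⟩ * b)   ≡⟨ -‿distribˡ-* _ b ⟩
      (- (c ⁻¹⟨ c≢0 ⟩)) * b ∎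
      where open ≡-Reasoning

  sumᶠ : ∀ {k} → Vec Carrier k → Carrier
  sumᶠ = foldr _ _+_ 0#

  sumᶠ-scale : ∀ {k} a (c : Vec Carrier k) → sumᶠ (Vec.map (a *_) c) ≡ a * sumᶠ c
  sumᶠ-scale a []       = sym (R.zeroʳ a)
  sumᶠ-scale a (c ∷ cs) = trans (cong (a * c +_) (sumᶠ-scale a cs)) (sym (R.distribˡ a c _))

  ·-lincomb : ∀ {d k} a (c : Vec Carrier k) (xs : Vec (Pt F d) k) →
              a · lincomb F c xs ≡ lincomb F (Vec.map (a *_) c) xs
  ·-lincomb a []       []       = ·-𝟎 a
  ·-lincomb a (c ∷ cs) (x ∷ xs) = trans (·-distrib-⊕ a _ _) (cong₂ _⊕_ (·-assoc a c x) (·-lincomb a cs xs))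

  ∙-lincomb : ∀ {d k} {t} (y : Pt F d) (c : Vec Carrier k) (xs : Vec (Pt F d) k) →
              All (λ x → y ∙ x ≡ t) xs → y ∙ lincomb F c xs ≡ sumᶠ c * t
  ∙-lincomb {t = t} y []       []       []           = trans (∙-𝟎 y) (sym (R.zeroˡ t))
  ∙-lincomb {t = t} y (c ∷ cs) (x ∷ xs) (y∙x≡t ∷ ts) = begin
    y ∙ (c · x ⊕ lincomb F cs xs)     ≡⟨ ∙-distribˡ-⊕ y _ _ ⟩
    y ∙ (c · x) + y ∙ lincomb F cs xs ≡⟨ cong₂ _+_ (trans (∙-·ʳ c y x) (cong (c *_) y∙x≡t)) (∙-lincomb y cs xs ts) ⟩
    c * t + sumᶠ cs * t               ≡⟨ R.distribʳ t c _ ⟨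
    (c + sumᶠ cs) * t                 ∎
    where open ≡-Reasoning

  points : (k : ℕ) → List (Pt F k)
  points zero    = [] ∷ []
  points (suc k) = concatMap (λ a → map (a ∷_) (points k)) elements

  ∈-points : ∀ {k} (x : Pt F k) → x ∈ points k
  ∈-points []            = Any.here refl
  ∈-points {suc k} (a ∷ x) = ∈-concatMap⁺ (λ a → map (a ∷_) (points k)) {xs = elements}
    (Any.map (λ { refl → ∈-map⁺ (a ∷_) (∈-points x) }) (complete a))

  length-points : ∀ k → length (points k) ≡ q ℕ.^ k
  length-points zero    = refl
  length-points (suc k) = begin
    length (points (suc k))                          ≡⟨ length-concatMap _ elements ⟩
    ∑[ a ∈ elements ] length (map (a ∷_) (points k)) ≡⟨ ∑-cong elements (λ a → trans (length-map (a ∷_) (points k)) (length-points k)) ⟩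
    ∑[ _ ∈ elements ] (q ℕ.^ k)                      ≡⟨ ∑-const elements (q ℕ.^ k) ⟩
    q ℕ.* q ℕ.^ k                                    ∎
    where open ≡-Reasoning

  ∑-points-suc : ∀ k (f : Pt F (suc k) → ℕ) → ∑ (points (suc k)) f ≡ ∑[ x ∈ points k ] ∑[ z ∈ elements ] f (z ∷ x)
  ∑-points-suc k f = begin
    ∑ (points (suc k)) f                          ≡⟨ ∑-concatMap _ elements f ⟩
    ∑[ z ∈ elements ] ∑ (map (z ∷_) (points k)) f ≡⟨ ∑-cong elements (λ z → ∑-map (z ∷_) (points k) f) ⟩
    ∑[ z ∈ elements ] ∑[ x ∈ points k ] f (z ∷ x) ≡⟨ ∑-swap elements (points k) _ ⟩
    ∑[ x ∈ points k ] ∑[ z ∈ elements ] f (z ∷ x) ∎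
    where open ≡-Reasoning

  0*z+r≡r : ∀ z r → 0# * z + r ≡ r
  0*z+r≡r z r = trans (cong (_+ r) (R.zeroˡ z)) (R.+-identityˡ r)

  𝟙-0*z+ : ∀ z r s → 𝟙 (0# * z + r ≟ᶠ s) ≡ 𝟙 (r ≟ᶠ s)
  𝟙-0*z+ z r s = 𝟙-cong (0# * z + r ≟ᶠ s) (r ≟ᶠ s) (trans (sym (0*z+r≡r z r))) (trans (0*z+r≡r z r))

  hyperplane-count : ∀ {k} → Pt F k → Carrier → ℕ
  hyperplane-count {k} y s = ∑[ x ∈ points k ] 𝟙 (y ∙ x ≟ᶠ s)

  q*hyperplane-count≡q^k : ∀ {k} (y : Pt F k) s → y ≢ 𝟎 → q ℕ.* hyperplane-count y s ≡ q ℕ.^ k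
  q*hyperplane-count≡q^k []              s y≢𝟎 = ⊥-elim (y≢𝟎 refl)
  q*hyperplane-count≡q^k {suc k} (a ∷ u) s y≢𝟎 with a ≟ᶠ 0#
  ... | no a≢0 = cong (q ℕ.*_) (begin
    hyperplane-count (a ∷ u) s                                 ≡⟨ ∑-points-suc k _ ⟩
    ∑[ x ∈ points k ] ∑[ z ∈ elements ] 𝟙 (a * z + u ∙ x ≟ᶠ s) ≡⟨ ∑-cong (points k) (λ x → count-linear a (u ∙ x) s a≢0) ⟩
    ∑[ _ ∈ points k ] 1                                        ≡⟨ length≡∑1 (points k) ⟨
    length (points k)                                          ≡⟨ length-points k ⟩
    q ℕ.^ k                                                    ∎)
    where open ≡-Reasoning
  ... | yes refl = cong (q ℕ.*_) (begin
    hyperplane-count (0# ∷ u) s                                 ≡⟨ ∑-points-suc k _ ⟩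
    ∑[ x ∈ points k ] ∑[ z ∈ elements ] 𝟙 (0# * z + u ∙ x ≟ᶠ s) ≡⟨ ∑-cong (points k) (λ x → ∑-cong elements (λ z → 𝟙-0*z+ z (u ∙ x) s)) ⟩
    ∑[ x ∈ points k ] ∑[ _ ∈ elements ] 𝟙 (u ∙ x ≟ᶠ s)          ≡⟨ ∑-cong (points k) (λ x → ∑-const elements _) ⟩
    ∑[ x ∈ points k ] (q ℕ.* 𝟙 (u ∙ x ≟ᶠ s))                    ≡⟨ ∑-*ˡ q (points k) _ ⟩
    q ℕ.* hyperplane-count u s                                  ≡⟨ q*hyperplane-count≡q^k u s (λ u≡𝟎 → y≢𝟎 (cong (0# ∷_) u≡𝟎)) ⟩
    q ℕ.^ k                                                     ∎)
    where open ≡-Reasoning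

  pair-count : ∀ {k} → Pt F k → Carrier → Pt F k → Carrier → ℕ
  pair-count {k} y s y′ s′ = ∑[ x ∈ points k ] (𝟙 (y ∙ x ≟ᶠ s) ℕ.* 𝟙 (y′ ∙ x ≟ᶠ s′))

  eliminate : ∀ a b c z r r′ → c * a ≡ b → (b * z + r′) + - (c * (a * z + r)) ≡ r′ + - (c * r)
  eliminate a b c z r r′ ca≡b = begin
    (b * z + r′) + - (c * (a * z + r))           ≡⟨ cong (λ w → (b * z + r′) + - w) (R.distribˡ c _ _) ⟩
    (b * z + r′) + - (c * (a * z) + c * r)       ≡⟨ cong ((b * z + r′) +_) (-‿+-comm _ _) ⟨
    (b * z + r′) + (- (c * (a * z)) + - (c * r)) ≡⟨ interchange _ _ _ _ ⟩
    (b * z + - (c * (a * z))) + (r′ + - (c * r)) ≡⟨ cong (λ w → (b * z + - w) + (r′ + - (c * r))) caz≡bz ⟩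
    (b * z + - (b * z)) + (r′ + - (c * r))       ≡⟨ cong (_+ (r′ + - (c * r))) (R.-‿inverseʳ _) ⟩
    0# + (r′ + - (c * r))                        ≡⟨ R.+-identityˡ _ ⟩
    r′ + - (c * r)                               ∎
    where
    open ≡-Reasoning
    caz≡bz : c * (a * z) ≡ b * z
    caz≡bz = trans (sym (R.*-assoc c a z)) (cong (_* z) ca≡b)

  [u′⊕-c·u]∙x : ∀ {k} c (u′ u x : Pt F k) → (u′ ⊕ (- c) · u) ∙ x ≡ u′ ∙ x + - (c * (u ∙ x))
  [u′⊕-c·u]∙x c u′ u x = begin
    (u′ ⊕ (- c) · u) ∙ x     ≡⟨ ∙-distribʳ-⊕ u′ _ x ⟩
    u′ ∙ x + ((- c) · u) ∙ x ≡⟨ cong (u′ ∙ x +_) (∙-·ˡ (- c) u x) ⟩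
    u′ ∙ x + (- c) * (u ∙ x) ≡⟨ cong (u′ ∙ x +_) (-‿distribˡ-* c _) ⟨
    u′ ∙ x + - (c * (u ∙ x)) ∎
    where open ≡-Reasoning

  pair-count-pivot : ∀ {k} a b (u u′ : Pt F k) s s′ (a≢0 : a ≢ 0#) → let c = b * a ⁻¹⟨ a≢0 ⟩ in
    pair-count (a ∷ u) s (b ∷ u′) s′ ≡ hyperplane-count (u′ ⊕ (- c) · u) (s′ + - (c * s))
  pair-count-pivot {k} a b u u′ s s′ a≢0 = trans (∑-points-suc k _) (∑-cong (points k) column)
    where
    c = b * a ⁻¹⟨ a≢0 ⟩
    ca≡b : c * a ≡ b
    ca≡b = b*a⁻¹*a≡b a b a≢0
    w = u′ ⊕ (- c) · u
    s″ = s′ + - (c * s)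
    column : ∀ x → ∑[ z ∈ elements ] (𝟙 (a * z + u ∙ x ≟ᶠ s) ℕ.* 𝟙 (b * z + u′ ∙ x ≟ᶠ s′)) ≡ 𝟙 (w ∙ x ≟ᶠ s″)
    column x = begin
      ∑[ z ∈ elements ] (𝟙 (a * z + u ∙ x ≟ᶠ s) ℕ.* 𝟙 (b * z + u′ ∙ x ≟ᶠ s′))
        ≡⟨ ∑-cong elements (λ z → 𝟙*𝟙-cong (a * z + u ∙ x ≟ᶠ s) _ (w ∙ x ≟ᶠ s″) (to z) (from z)) ⟩
      ∑[ z ∈ elements ] (𝟙 (a * z + u ∙ x ≟ᶠ s) ℕ.* 𝟙 (w ∙ x ≟ᶠ s″))
        ≡⟨ ∑-*ʳ _ elements (λ z → 𝟙 (a * z + u ∙ x ≟ᶠ s)) ⟩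
      ∑[ z ∈ elements ] 𝟙 (a * z + u ∙ x ≟ᶠ s) ℕ.* 𝟙 (w ∙ x ≟ᶠ s″)
        ≡⟨ cong (ℕ._* 𝟙 (w ∙ x ≟ᶠ s″)) (count-linear a (u ∙ x) s a≢0) ⟩
      1 ℕ.* 𝟙 (w ∙ x ≟ᶠ s″)
        ≡⟨ ℕ.*-identityˡ _ ⟩
      𝟙 (w ∙ x ≟ᶠ s″) ∎
      where
      open ≡-Reasoning
      to : ∀ z → a * z + u ∙ x ≡ s → b * z + u′ ∙ x ≡ s′ → w ∙ x ≡ s″
      to z refl refl = trans ([u′⊕-c·u]∙x c u′ u x) (sym (eliminate a b c z (u ∙ x) (u′ ∙ x) ca≡b))
      from : ∀ z → a * z + u ∙ x ≡ s → w ∙ x ≡ s″ → b * z + u′ ∙ x ≡ s′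
      from z refl w∙x≡s″ = +-cancelʳ (- (c * s)) _ _
        (trans (eliminate a b c z (u ∙ x) (u′ ∙ x) ca≡b) (trans (sym ([u′⊕-c·u]∙x c u′ u x)) w∙x≡s″))

  pair-count-0∷-pivot : ∀ {k} b (u u′ : Pt F k) s s′ → b ≢ 0# →
    pair-count (0# ∷ u) s (b ∷ u′) s′ ≡ hyperplane-count u s
  pair-count-0∷-pivot {k} b u u′ s s′ b≢0 = trans (∑-points-suc k _) (∑-cong (points k) column)
    where
    column : ∀ x → ∑[ z ∈ elements ] (𝟙 (0# * z + u ∙ x ≟ᶠ s) ℕ.* 𝟙 (b * z + u′ ∙ x ≟ᶠ s′)) ≡ 𝟙 (u ∙ x ≟ᶠ s)
    column x = begin
      ∑[ z ∈ elements ] (𝟙 (0# * z + u ∙ x ≟ᶠ s) ℕ.* 𝟙 (b * z + u′ ∙ x ≟ᶠ s′))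
        ≡⟨ ∑-cong elements (λ z → cong (ℕ._* 𝟙 (b * z + u′ ∙ x ≟ᶠ s′)) (𝟙-0*z+ z (u ∙ x) s)) ⟩
      ∑[ z ∈ elements ] (𝟙 (u ∙ x ≟ᶠ s) ℕ.* 𝟙 (b * z + u′ ∙ x ≟ᶠ s′))
        ≡⟨ ∑-*ˡ (𝟙 (u ∙ x ≟ᶠ s)) elements (λ z → 𝟙 (b * z + u′ ∙ x ≟ᶠ s′)) ⟩
      𝟙 (u ∙ x ≟ᶠ s) ℕ.* ∑[ z ∈ elements ] 𝟙 (b * z + u′ ∙ x ≟ᶠ s′)
        ≡⟨ cong (𝟙 (u ∙ x ≟ᶠ s) ℕ.*_) (count-linear b (u′ ∙ x) s′ b≢0) ⟩
      𝟙 (u ∙ x ≟ᶠ s) ℕ.* 1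
        ≡⟨ ℕ.*-identityʳ _ ⟩
      𝟙 (u ∙ x ≟ᶠ s) ∎
      where open ≡-Reasoning

  pair-count-0∷-0∷ : ∀ {k} (u u′ : Pt F k) s s′ → pair-count (0# ∷ u) s (0# ∷ u′) s′ ≡ q ℕ.* pair-count u s u′ s′
  pair-count-0∷-0∷ {k} u u′ s s′ = begin
    pair-count (0# ∷ u) s (0# ∷ u′) s′
      ≡⟨ ∑-points-suc k _ ⟩
    ∑[ x ∈ points k ] ∑[ z ∈ elements ] (𝟙 (0# * z + u ∙ x ≟ᶠ s) ℕ.* 𝟙 (0# * z + u′ ∙ x ≟ᶠ s′))
      ≡⟨ ∑-cong (points k) (λ x → ∑-cong elements (λ z → cong₂ ℕ._*_ (𝟙-0*z+ z (u ∙ x) s) (𝟙-0*z+ z (u′ ∙ x) s′))) ⟩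
    ∑[ x ∈ points k ] ∑[ _ ∈ elements ] (𝟙 (u ∙ x ≟ᶠ s) ℕ.* 𝟙 (u′ ∙ x ≟ᶠ s′))
      ≡⟨ ∑-cong (points k) (λ x → ∑-const elements _) ⟩
    ∑[ x ∈ points k ] (q ℕ.* (𝟙 (u ∙ x ≟ᶠ s) ℕ.* 𝟙 (u′ ∙ x ≟ᶠ s′)))
      ≡⟨ ∑-*ˡ q (points k) _ ⟩
    q ℕ.* pair-count u s u′ s′ ∎
    where open ≡-Reasoning

  q²*pair-count≡q^k : ∀ {k} (y : Pt F k) s (y′ : Pt F k) s′ → y ≢ 𝟎 → (∀ c → y′ ≢ c · y) →
                      q ℕ.* (q ℕ.* pair-count y s y′ s′) ≡ q ℕ.^ k
  q²*pair-count≡q^k []      s []       s′ y≢𝟎 _ = ⊥-elim (y≢𝟎 refl)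
  q²*pair-count≡q^k (a ∷ u) s (b ∷ u′) s′ y≢𝟎 y′∉𝔽y with a ≟ᶠ 0# | b ≟ᶠ 0#
  ... | no a≢0 | _ = cong (q ℕ.*_) (trans (cong (q ℕ.*_) (pair-count-pivot a b u u′ s s′ a≢0))
                                        (q*hyperplane-count≡q^k _ _ w≢𝟎))
    where
    c = b * a ⁻¹⟨ a≢0 ⟩
    w≢𝟎 : u′ ⊕ (- c) · u ≢ 𝟎
    w≢𝟎 w≡𝟎 = y′∉𝔽y c (cong₂ _∷_ (sym (b*a⁻¹*a≡b a b a≢0)) (u⊕-c·v≡𝟎⇒u≡c·v c u′ u w≡𝟎))
  ... | yes refl | no b≢0 = cong (q ℕ.*_) (trans (cong (q ℕ.*_) (pair-count-0∷-pivot b u u′ s s′ b≢0))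
                                              (q*hyperplane-count≡q^k u s (λ u≡𝟎 → y≢𝟎 (cong (0# ∷_) u≡𝟎))))
  ... | yes refl | yes refl = trans (cong (λ n → q ℕ.* (q ℕ.* n)) (pair-count-0∷-0∷ u u′ s s′))
    (cong (q ℕ.*_) (q²*pair-count≡q^k u s u′ s′ (λ u≡𝟎 → y≢𝟎 (cong (0# ∷_) u≡𝟎))
                                                  (λ c u′≡c·u → y′∉𝔽y c (cong₂ _∷_ (sym (R.zeroʳ c)) u′≡c·u))))

  -- A coefficient vector summing to 1 is determined by all but its first entry.
  affine-combinations : ∀ {d k} → Vec (Pt F d) k → List (Pt F d)
  affine-combinations {k = zero}  [] = []
  affine-combinations {k = suc m} xs = map (λ c → lincomb F ((1# + - sumᶠ c) ∷ c) xs) (points m)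

  ∈-affine-combinations : ∀ {d k} (xs : Vec (Pt F d) k) (c : Vec Carrier k) → sumᶠ c ≡ 1# →
                          lincomb F c xs ∈ affine-combinations xs
  ∈-affine-combinations []         []      0≡1 = ⊥-elim (0≢1 0≡1)
  ∈-affine-combinations xs@(_ ∷ _) (a ∷ c) Σc≡1 =
    subst (λ a → lincomb F (a ∷ c) xs ∈ affine-combinations xs) (sym (a+b≡c⇒a≡c-b Σc≡1))
      (∈-map⁺ (λ c → lincomb F ((1# + - sumᶠ c) ∷ c) xs) (∈-points c))

  length-affine-combinations : ∀ {d k} (xs : Vec (Pt F d) k) → suc k ℕ.≤ d →
                               length (affine-combinations xs) ℕ.≤ q ℕ.^ (d ℕ.∸ 2)
  length-affine-combinations {k = zero}      []         _   = ℕ.z≤n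
  length-affine-combinations {d} {suc m} xs@(_ ∷ _) k<d = begin
    length (affine-combinations xs) ≡⟨ length-map _ (points m) ⟩
    length (points m)               ≡⟨ length-points m ⟩
    q ℕ.^ m                         ≤⟨ ℕ.^-monoʳ-≤ q {{q-nonZero}} (ℕ.∸-monoˡ-≤ 2 k<d) ⟩
    q ℕ.^ (d ℕ.∸ 2)                 ∎
    where open ℕ.≤-Reasoning

  infix 4 _≟ᵛ_
  _≟ᵛ_ : ∀ {k} → DecidableEquality (Pt F k)
  _≟ᵛ_ = Vecₚ.≡-dec _≟_

  module Incidence (d : ℕ) (t : Carrier) (t≢0 : t ≢ 0#) where

    nonzero : Pt F d → ℕ
    nonzero y = 𝟙 (¬? (y ≟ᵛ 𝟎))

    incident : Pt F d → Pt F d → ℕ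
    incident y x = 𝟙 (y ∙ x ≟ᶠ t)

    𝟎-not-incident : ∀ x → incident 𝟎 x ≡ 0
    𝟎-not-incident x = 𝟙-≡0 (𝟎 ∙ x ≟ᶠ t) (λ 𝟎∙x≡t → t≢0 (trans (sym 𝟎∙x≡t) (𝟎-∙ x)))

    first-moment : ∀ y → q ℕ.* ∑ (points d) (incident y) ≡ nonzero y ℕ.* q ℕ.^ d
    first-moment y with y ≟ᵛ 𝟎
    ... | yes refl = trans (cong (q ℕ.*_) (∑-0 (points d) _ 𝟎-not-incident)) (ℕ.*-zeroʳ q)
    ... | no y≢𝟎   = trans (q*hyperplane-count≡q^k y t y≢𝟎) (sym (ℕ.+-identityʳ _))

    parallel-not-incident : ∀ y c x → c · y ≢ y → incident y x ℕ.* incident (c · y) x ≡ 0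
    parallel-not-incident y c x c·y≢y with y ∙ x ≟ᶠ t | (c · y) ∙ x ≟ᶠ t
    ... | no _      | _            = refl
    ... | yes _     | no _         = refl
    ... | yes y∙x≡t | yes c·y∙x≡t  = ⊥-elim (c·y≢y (trans (cong (_· y) c≡1) (·-identityˡ y)))
      where
      c≡1 : c ≡ 1#
      c≡1 = *-cancelˡ t t≢0 (begin
        t * c       ≡⟨ R.*-comm t c ⟩
        c * t       ≡⟨ cong (c *_) y∙x≡t ⟨
        c * (y ∙ x) ≡⟨ ∙-·ˡ c y x ⟨
        (c · y) ∙ x ≡⟨ c·y∙x≡t ⟩
        t           ≡⟨ R.*-identityʳ t ⟨
        t * 1#      ∎)
        where open ≡-Reasoning

    q²*0≤ : ∀ {p n} → p ≡ 0 → q ℕ.* (q ℕ.* p) ℕ.≤ n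
    q²*0≤ refl = ℕ.≤-trans (ℕ.≤-reflexive (trans (cong (q ℕ.*_) (ℕ.*-zeroʳ q)) (ℕ.*-zeroʳ q))) ℕ.z≤n

    second-moment : ∀ y y′ →
      q ℕ.* (q ℕ.* ∑[ x ∈ points d ] (incident y x ℕ.* incident y′ x)) ℕ.≤
      𝟙 (y′ ≟ᵛ y) ℕ.* (nonzero y ℕ.* (q ℕ.* q ℕ.^ d)) ℕ.+ nonzero y ℕ.* nonzero y′ ℕ.* q ℕ.^ d
    second-moment y y′ with y ≟ᵛ 𝟎 | y′ ≟ᵛ 𝟎
    ... | yes refl | _ = q²*0≤ (∑-0 (points d) _ (λ x → cong (ℕ._* incident y′ x) (𝟎-not-incident x)))
    ... | no _ | yes refl =
      q²*0≤ (∑-0 (points d) _ (λ x → trans (cong (incident y x ℕ.*_) (𝟎-not-incident x)) (ℕ.*-zeroʳ (incident y x))))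
    ... | no y≢𝟎 | no _ with y′ ≟ᵛ y
    ...   | yes refl = ℕ.≤-trans (ℕ.≤-reflexive diagonal) (ℕ.m≤m+n _ _)
      where
      diagonal : q ℕ.* (q ℕ.* ∑[ x ∈ points d ] (incident y x ℕ.* incident y x)) ≡ 1 ℕ.* (1 ℕ.* (q ℕ.* q ℕ.^ d))
      diagonal = begin
        q ℕ.* (q ℕ.* ∑[ x ∈ points d ] (incident y x ℕ.* incident y x))
          ≡⟨ cong (λ n → q ℕ.* (q ℕ.* n)) (∑-cong (points d) (λ x → 𝟙-idem (y ∙ x ≟ᶠ t))) ⟩
        q ℕ.* (q ℕ.* hyperplane-count y t) ≡⟨ cong (q ℕ.*_) (q*hyperplane-count≡q^k y t y≢𝟎) ⟩
        q ℕ.* q ℕ.^ d                      ≡⟨ trans (ℕ.*-identityˡ _) (ℕ.*-identityˡ _) ⟨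
        1 ℕ.* (1 ℕ.* (q ℕ.* q ℕ.^ d))      ∎
        where open ≡-Reasoning
    ...   | no y′≢y with any? (λ c → y′ ≟ᵛ c · y) elements
    ...     | yes y′∈𝔽y with find y′∈𝔽y
    ...       | c , _ , refl = q²*0≤ (∑-0 (points d) _ (λ x → parallel-not-incident y c x y′≢y))
    second-moment y y′ | no y≢𝟎 | no _ | no y′≢y | no y′∉𝔽y =
      ℕ.≤-reflexive (trans (q²*pair-count≡q^k y t y′ t y≢𝟎 y′≢𝔽y) (sym (ℕ.+-identityʳ _)))
      where
      y′≢𝔽y : ∀ c → y′ ≢ c · y
      y′≢𝔽y c y′≡c·y = y′∉𝔽y (Any.map (λ { refl → y′≡c·y }) (complete c))

    module _ (y : Pt F d) where

      OnHyperplane : Pt F d → Set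
      OnHyperplane x = y ∙ x ≡ t

      -- Dotting the dependence with y gives (c₀ + Σc)·t = 0, so dividing it by −c₀ makes it affine.
      dependent⇒affine : ∀ {k} (xs : Vec (Pt F d) k) (x : Pt F d) (c₀ : Carrier) (c : Vec Carrier k) →
                         All OnHyperplane xs → OnHyperplane x → c₀ ≢ 0# →
                         c₀ · x ⊕ lincomb F c xs ≡ 𝟎 → x ∈ affine-combinations xs
      dependent⇒affine xs x c₀ c xs⊆H x∈H c₀≢0 dependence =
        subst (_∈ affine-combinations xs) (sym x≡combination) (∈-affine-combinations xs c′ Σc′≡1)
        where
        e : Carrier
        e = - (c₀ ⁻¹⟨ c₀≢0 ⟩)
        c′ = Vec.map (e *_) c
        [c₀+Σc]*t≡0 : (c₀ + sumᶠ c) * t ≡ 0#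
        [c₀+Σc]*t≡0 = begin
          (c₀ + sumᶠ c) * t                 ≡⟨ R.distribʳ t c₀ _ ⟩
          c₀ * t + sumᶠ c * t               ≡⟨ cong₂ _+_ (cong (c₀ *_) x∈H) (∙-lincomb y c xs xs⊆H) ⟨
          c₀ * (y ∙ x) + y ∙ lincomb F c xs ≡⟨ cong (_+ _) (∙-·ʳ c₀ y x) ⟨
          y ∙ (c₀ · x) + y ∙ lincomb F c xs ≡⟨ ∙-distribˡ-⊕ y _ _ ⟨
          y ∙ (c₀ · x ⊕ lincomb F c xs)     ≡⟨ cong (y ∙_) dependence ⟩
          y ∙ 𝟎                             ≡⟨ ∙-𝟎 y ⟩
          0#                                ∎
          where open ≡-Reasoning
        Σc≡-c₀ : sumᶠ c ≡ - c₀
        Σc≡-c₀ = +-inverseˡ-unique (sumᶠ c) c₀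
          (trans (R.+-comm _ c₀) (a*b≡0⇒b≡0 t t≢0 (trans (R.*-comm t _) [c₀+Σc]*t≡0)))
        Σc′≡1 : sumᶠ c′ ≡ 1#
        Σc′≡1 = begin
          sumᶠ c′            ≡⟨ sumᶠ-scale e c ⟩
          e * sumᶠ c         ≡⟨ cong (e *_) Σc≡-c₀ ⟩
          e * - c₀           ≡⟨ -a*-b≡a*b _ c₀ ⟩
          c₀ ⁻¹⟨ c₀≢0 ⟩ * c₀ ≡⟨ *-inverseˡ c₀ c₀≢0 ⟩
          1#                 ∎
          where open ≡-Reasoning
        x≡combination : x ≡ lincomb F c′ xs
        x≡combination = trans (solve-for c₀ c₀≢0 x _ dependence) (·-lincomb e c xs)

      LinIndep-∷ : ∀ {k} (xs : Vec (Pt F d) k) (x : Pt F d) → All OnHyperplane xs → OnHyperplane x →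
                   LinIndep F xs → x ∉ affine-combinations xs → LinIndep F (x ∷ xs)
      LinIndep-∷ xs x xs⊆H x∈H xs-indep x∉affine (c₀ ∷ c) dependence with c₀ ≟ᶠ 0#
      ... | yes refl = cong (0# ∷_) (xs-indep c (trans (sym (0·x⊕v≡v x _)) dependence))
      ... | no c₀≢0  = ⊥-elim (x∉affine (dependent⇒affine xs x c₀ c xs⊆H x∈H c₀≢0 dependence))

    module Leaves (E : List (Pt F d)) (!E : Unique E) (y : Pt F d) where
      open import Data.List.Membership.DecPropositional (_≟ᵛ_ {d}) using (_∈?_)

      neighbours : List (Pt F d)
      neighbours = filter (λ x → y ∙ x ≟ᶠ t) E

      extensions : ∀ {k} → Vec (Pt F d) k → List (Pt F d)
      extensions xs = filter (λ x → ¬? (x ∈? affine-combinations xs)) neighbours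

      independent-tuples : (k : ℕ) → List (Vec (Pt F d) k)
      independent-tuples zero    = [] ∷ []
      independent-tuples (suc k) = concatMap (λ xs → map (_∷ xs) (extensions xs)) (independent-tuples k)

      ∈-independent-tuples : ∀ {k} {xs : Vec (Pt F d) k} → xs ∈ independent-tuples k →
                             All (_∈ E) xs × All (OnHyperplane y) xs × LinIndep F xs
      ∈-independent-tuples {zero} {[]} _ = [] , [] , λ { [] _ → refl }
      ∈-independent-tuples {suc k} p
        with xs , xs∈tuples , x∷xs∈ ← find (∈-concatMap⁻ (λ xs → map (_∷ xs) (extensions xs)) {xs = independent-tuples k} p)
        with x , x∈extensions , refl ← ∈-map⁻ (_∷ xs) x∷xs∈
        with x∈neighbours , x∉affine ← ∈-filter⁻ (λ x → ¬? (x ∈? affine-combinations xs)) {xs = neighbours} x∈extensions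
        with x∈E , x∈H ← ∈-filter⁻ (λ x → y ∙ x ≟ᶠ t) {xs = E} x∈neighbours
        with xs⊆E , xs⊆H , xs-indep ← ∈-independent-tuples xs∈tuples
        = x∈E ∷ xs⊆E , x∈H ∷ xs⊆H , LinIndep-∷ y xs x xs⊆H x∈H xs-indep x∉affine

      Unique-neighbours : Unique neighbours
      Unique-neighbours = Unique.filter⁺ (λ x → y ∙ x ≟ᶠ t) !E

      Unique-independent-tuples : ∀ k → Unique (independent-tuples k)
      Unique-independent-tuples zero    = ListAll.[] ∷ []
      Unique-independent-tuples (suc k) =
        Unique-concatMap _ (independent-tuples k) (Unique-independent-tuples k)
          (λ xs → Unique.map⁺ Vecₚ.∷-injectiveˡ (Unique.filter⁺ _ Unique-neighbours))
          same-tail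
        where
        same-tail : ∀ xs xs′ {v} → v ∈ map (_∷ xs) (extensions xs) → v ∈ map (_∷ xs′) (extensions xs′) → xs ≡ xs′
        same-tail xs xs′ p p′ with _ , _ , refl ← ∈-map⁻ (_∷ xs) p | _ , _ , eq ← ∈-map⁻ (_∷ xs′) p′ = Vecₚ.∷-injectiveʳ eq

      length-extensions : ∀ {k} (xs : Vec (Pt F d) k) →
                          length neighbours ℕ.∸ length (affine-combinations xs) ℕ.≤ length (extensions xs)
      length-extensions xs = ℕ.m≤n+o⇒m∸n≤o (length neighbours) _ (begin
        length neighbours
          ≡⟨ length-filter-complement (_∈? affine-combinations xs) neighbours ⟨
        length (filter (_∈? affine-combinations xs) neighbours) ℕ.+ length (extensions xs)
          ≤⟨ ℕ.+-monoˡ-≤ _ (length-⊆ _ _ (Unique.filter⁺ _ Unique-neighbours) (λ p → proj₂ (∈-filter⁻ _ {xs = neighbours} p))) ⟩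
        length (affine-combinations xs) ℕ.+ length (extensions xs) ∎)
        where open ℕ.≤-Reasoning

      length-independent-tuples : ∀ k → k ℕ.≤ d →
        (length neighbours ℕ.∸ q ℕ.^ (d ℕ.∸ 2)) ℕ.^ k ℕ.≤ length (independent-tuples k)
      length-independent-tuples zero    _   = ℕ.≤-refl
      length-independent-tuples (suc k) k<d = begin
        g ℕ.^ suc k                                                         ≡⟨ ℕ.*-comm g (g ℕ.^ k) ⟩
        g ℕ.^ k ℕ.* g                                                       ≤⟨ ℕ.*-monoˡ-≤ g (length-independent-tuples k (ℕ.<⇒≤ k<d)) ⟩
        length (independent-tuples k) ℕ.* g                                 ≡⟨ ∑-const (independent-tuples k) g ⟨
        ∑[ _ ∈ independent-tuples k ] g                                     ≤⟨ ∑-mono (independent-tuples k) at-least-g ⟩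
        ∑[ xs ∈ independent-tuples k ] length (map (_∷ xs) (extensions xs)) ≡⟨ length-concatMap _ (independent-tuples k) ⟨
        length (independent-tuples (suc k))                                 ∎
        where
        open ℕ.≤-Reasoning
        g = length neighbours ℕ.∸ q ℕ.^ (d ℕ.∸ 2)
        at-least-g : ∀ xs → g ℕ.≤ length (map (_∷ xs) (extensions xs))
        at-least-g xs = ℕ.≤-trans (ℕ.∸-monoʳ-≤ (length neighbours) (length-affine-combinations xs k<d))
                                  (ℕ.≤-trans (length-extensions xs) (ℕ.≤-reflexive (sym (length-map (_∷ xs) (extensions xs)))))

module StarCount (F : FiniteField) (e : ℕ) (t : FiniteField.Carrier F) (t≢0 : t ≢ FiniteField.0# F)
                (E : List (Pt F (suc (suc (suc e))))) (!E : Unique E) where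

  open import Data.Nat
  open import Data.Nat.Properties
  open import Data.Nat.Tactic.RingSolver using (solve-∀)
  open import Data.List using (map; concatMap)
  open import Data.List.Properties using (length-map)
  open import Data.List.Membership.Propositional using (find)
  open import Data.List.Membership.Propositional.Properties using (∈-map⁻; ∈-concatMap⁻)
  import Data.List.Relation.Unary.Unique.Propositional.Properties as Unique
  open import Data.Vec.Relation.Unary.All.Properties using (lookup⁺)
  open import Data.Product using (proj₁)
  import Data.Product.Properties as Product
  open import Function.Bundles using (Equivalence)
  open import Relation.Nullary using (¬?)
  open import Relation.Binary.PropositionalEquality
  open Sums
  open Inequalities
  open FieldAlgebra F

  m d : ℕ
  m = suc (suc e)
  d = suc m
  open Incidence d t t≢0
  open Leaves E !E using (neighbours; independent-tuples; ∈-independent-tuples; Unique-independent-tuples; length-independent-tuples)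
  module Moments = SecondMoment _≟ᵛ_ E !E (points d) q (q ^ d) (length-points d) nonzero incident first-moment second-moment
  open Moments using (h; deviation) renaming (m to n′)

  n M : ℕ
  n = length E
  M = q ^ m

  g : Pt F d → ℕ
  g y = length (neighbours y) ∸ q ^ (d ∸ 2)

  G : ℕ
  G = ∑ E g

  stars : List (Pt F d × Vec (Pt F d) d)
  stars = concatMap (λ y → map (y ,_) (independent-tuples y d)) E

  Unique-stars : Unique stars
  Unique-stars = Unique-concatMap _ E !E (λ y → Unique.map⁺ Product.,-injectiveʳ (Unique-independent-tuples y d)) same-centre
    where
    same-centre : ∀ y y′ {τ} → τ ∈ map (y ,_) (independent-tuples y d) → τ ∈ map (y′ ,_) (independent-tuples y′ d) → y ≡ y′
    same-centre y y′ p p′ with _ , _ , refl ← ∈-map⁻ (y ,_) p | _ , _ , eq ← ∈-map⁻ (y′ ,_) p′ = cong proj₁ eq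

  ∈-stars⇒IsIndepStar : ∀ {τ} → τ ∈ stars → IsIndepStar F E t τ
  ∈-stars⇒IsIndepStar p
    with y , y∈E , τ∈ ← find (∈-concatMap⁻ (λ y → map (y ,_) (independent-tuples y d)) {xs = E} p)
    with xs , xs∈tuples , refl ← ∈-map⁻ (y ,_) τ∈
    with xs⊆E , xs⊆H , xs-indep ← ∈-independent-tuples y xs∈tuples
    = y∈E , xs⊆E , lookup⁺ xs⊆H , xs-indep

  ∑g^d≤|stars| : ∑[ y ∈ E ] (g y ^ d) ≤ length stars
  ∑g^d≤|stars| = begin
    ∑[ y ∈ E ] (g y ^ d)                                    ≤⟨ ∑-mono E (λ y → length-independent-tuples y d ≤-refl) ⟩
    ∑[ y ∈ E ] length (independent-tuples y d)              ≡⟨ ∑-cong E (λ y → length-map (y ,_) (independent-tuples y d)) ⟨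
    ∑[ y ∈ E ] length (map (y ,_) (independent-tuples y d)) ≡⟨ length-concatMap _ E ⟨
    length stars                                            ∎
    where open ≤-Reasoning

  [qG]^d≤q^d*n^[d-1]*|N| : (N : List (Pt F d × Vec (Pt F d) d)) → Unique N → (∀ τ → (τ ∈ N) ⇔ IsIndepStar F E t τ) →
                           (q * G) ^ d ≤ q ^ d * n ^ m * length N
  [qG]^d≤q^d*n^[d-1]*|N| N !N N≡stars = begin
    (q * G) ^ d                            ≡⟨ ^-distribʳ-* q G d ⟩
    q ^ d * G ^ d                          ≤⟨ *-monoʳ-≤ (q ^ d) (∑-power-mean E g m) ⟩
    q ^ d * (n ^ m * ∑[ y ∈ E ] (g y ^ d)) ≤⟨ *-monoʳ-≤ (q ^ d) (*-monoʳ-≤ (n ^ m) ∑g^d≤|N|) ⟩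
    q ^ d * (n ^ m * length N)             ≡⟨ *-assoc (q ^ d) _ _ ⟨
    q ^ d * n ^ m * length N               ∎
    where
    open ≤-Reasoning
    ∑g^d≤|N| : ∑[ y ∈ E ] (g y ^ d) ≤ length N
    ∑g^d≤|N| = ≤-trans ∑g^d≤|stars|
      (length-⊆ stars N Unique-stars (λ {τ} p → Equivalence.from (N≡stars τ) (∈-stars⇒IsIndepStar p)))

  n′≤n : n′ ≤ n
  n′≤n = subst (n′ ≤_) (sym (length≡∑1 E)) (∑-mono E (λ y → 𝟙≤1 (¬? (y ≟ᵛ 𝟎))))

  n≤n′+1 : n ≤ n′ + 1
  n≤n′+1 = begin
    n                                   ≡⟨ length≡∑1 E ⟩
    ∑[ _ ∈ E ] 1                        ≡⟨ ∑-cong E (λ y → sym (trans (+-comm (nonzero y) _) (𝟙+𝟙¬ (y ≟ᵛ 𝟎)))) ⟩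
    ∑[ y ∈ E ] (nonzero y + 𝟙 (y ≟ᵛ 𝟎)) ≡⟨ ∑-+ E _ _ ⟩
    n′ + ∑[ y ∈ E ] 𝟙 (y ≟ᵛ 𝟎)          ≤⟨ +-monoʳ-≤ n′ (count≤1 _≟ᵛ_ E 𝟎 !E) ⟩
    n′ + 1                              ∎
    where open ≤-Reasoning

  n*n′≤q*∑h+n*M : n * n′ ≤ q * ∑ E h + n * M
  n*n′≤q*∑h+n*M = ≤-trans (m≤n+m∸n (n * n′) (q * ∑ E h)) (+-monoʳ-≤ (q * ∑ E h)
    (*-cancelˡ-≤ (2 * M) {{m*n≢0 2 M {{_}} {{m^n≢0 q m {{q-nonZero}}}}}} (begin
      2 * M * (n * n′ ∸ q * ∑ E h)   ≡⟨ *-assoc 2 M _ ⟩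
      2 * (M * (n * n′ ∸ q * ∑ E h)) ≤⟨ deviation E !E (λ {x} _ → ∈-points x) M ⟩
      n′ * (q * q ^ d) + n * (M * M) ≤⟨ +-monoˡ-≤ (n * (M * M)) (*-mono-≤ n′≤n q^[d+1]≤M²) ⟩
      n * (M * M) + n * (M * M)      ≡⟨ double n M ⟩
      2 * M * (n * M)                ∎)))
    where
    open ≤-Reasoning
    double : ∀ n M → n * (M * M) + n * (M * M) ≡ 2 * M * (n * M)
    double = solve-∀
    q^[d+1]≤M² : q * q ^ d ≤ M * M
    q^[d+1]≤M² = subst (q ^ suc d ≤_) (^-distribˡ-+-* q m m) (^-monoʳ-≤ q {{q-nonZero}} (s≤s (s≤s (m≤n+m m e))))

  ∑h≤n*q^[d-2]+G : ∑ E h ≤ n * q ^ (d ∸ 2) + G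
  ∑h≤n*q^[d-2]+G = ≤-trans (m≤n+m∸n (∑ E h) (n * q ^ (d ∸ 2))) (+-monoʳ-≤ (n * q ^ (d ∸ 2)) (begin
    ∑ E h ∸ n * q ^ (d ∸ 2)                                     ≡⟨ cong₂ _∸_ ∑h≡∑|neighbours| (∑-const E (q ^ (d ∸ 2))) ⟨
    ∑[ y ∈ E ] length (neighbours y) ∸ ∑[ _ ∈ E ] (q ^ (d ∸ 2)) ≤⟨ ∑-∸ E _ _ ⟩
    G                                                           ∎))
    where
    open ≤-Reasoning
    ∑h≡∑|neighbours| : ∑[ y ∈ E ] length (neighbours y) ≡ ∑ E h
    ∑h≡∑|neighbours| = trans (∑-cong E (λ y → length-filter _ E)) (∑-swap E E (λ y x → incident y x))

  n²≤qG+3nM : n * n ≤ q * G + 3 * (n * M)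
  n²≤qG+3nM = begin
    n * n                                     ≤⟨ *-monoʳ-≤ n n≤n′+1 ⟩
    n * (n′ + 1)                              ≡⟨ distribute n n′ ⟩
    n * n′ + n                                ≤⟨ +-monoˡ-≤ n n*n′≤q*∑h+n*M ⟩
    q * ∑ E h + n * M + n                     ≤⟨ +-monoˡ-≤ n (+-monoˡ-≤ (n * M) (*-monoʳ-≤ q ∑h≤n*q^[d-2]+G)) ⟩
    q * (n * q ^ (d ∸ 2) + G) + n * M + n     ≤⟨ +-monoʳ-≤ _ n≤n*M ⟩
    q * (n * q ^ (d ∸ 2) + G) + n * M + n * M ≡⟨ collect q n (q ^ (d ∸ 2)) G ⟩
    q * G + 3 * (n * M)                       ∎
    where
    open ≤-Reasoning
    distribute : ∀ n n′ → n * (n′ + 1) ≡ n * n′ + n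
    distribute = solve-∀
    collect : ∀ q n X G → q * (n * X + G) + n * (q * X) + n * (q * X) ≡ q * G + 3 * (n * (q * X))
    collect = solve-∀
    n≤n*M : n ≤ n * M
    n≤n*M = ≤-trans (≤-reflexive (sym (*-identityʳ n))) (*-monoʳ-≤ n (m^n>0 q {{q-nonZero}} m))

  module _ (dense : (6 * d) ^ m * q ^ (d * m ∸ 1) ≤ n ^ m) where

    6dM≤n : 6 * d * M ≤ n
    6dM≤n = m^k≤n^k⇒m≤n m (begin
      (6 * d * M) ^ m               ≡⟨ ^-distribʳ-* (6 * d) M m ⟩
      (6 * d) ^ m * M ^ m           ≡⟨ cong ((6 * d) ^ m *_) (^-*-assoc q m m) ⟩
      (6 * d) ^ m * q ^ (m * m)     ≤⟨ *-monoʳ-≤ ((6 * d) ^ m) (^-monoʳ-≤ q {{q-nonZero}} (≤-trans (m≤n+m (m * m) e) (n≤1+n _))) ⟩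
      (6 * d) ^ m * q ^ (d * m ∸ 1) ≤⟨ dense ⟩
      n ^ m                         ∎)
      where open ≤-Reasoning

    [2d-1]n²≤2dqG : suc (m + m) * (n * n) ≤ suc (suc (m + m)) * (q * G)
    [2d-1]n²≤2dqG = +-cancelʳ-≤ (n * n) _ _ (begin
      suc (m + m) * (n * n) + n * n                 ≡⟨ absorb m (n * n) ⟩
      suc (suc (m + m)) * (n * n)                   ≤⟨ *-monoʳ-≤ (suc (suc (m + m))) n²≤qG+3nM ⟩
      suc (suc (m + m)) * (q * G + 3 * (n * M))     ≡⟨ expand m (q * G) n M ⟩
      suc (suc (m + m)) * (q * G) + n * (6 * d * M) ≤⟨ +-monoʳ-≤ _ (*-monoʳ-≤ n 6dM≤n) ⟩
      suc (suc (m + m)) * (q * G) + n * n           ∎)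
      where
      open ≤-Reasoning
      absorb : ∀ m X → suc (m + m) * X + X ≡ suc (suc (m + m)) * X
      absorb = solve-∀
      expand : ∀ m H n M → suc (suc (m + m)) * (H + 3 * (n * M)) ≡ suc (suc (m + m)) * H + n * (6 * suc m * M)
      expand = solve-∀

    n^[d+1]≤3q^d|N| : (N : List (Pt F d × Vec (Pt F d) d)) → Unique N → (∀ τ → (τ ∈ N) ⇔ IsIndepStar F E t τ) →
                      n ^ (d + 1) ≤ 3 * q ^ d * length N
    n^[d+1]≤3q^d|N| N !N N≡stars =
      n^[d+1]≤3QN m n (length N) (q * G) (q ^ d) ([qG]^d≤q^d*n^[d-1]*|N| N !N N≡stars) [2d-1]n²≤2dqG

-- Opened only here: in FieldAlgebra these operators would clash with those of the field.
open import Data.Nat using (_≤_; _*_; _^_; _∸_; _+_; s≤s)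

lemma2p5 : (d : ℕ) → 3 ≤ d →
    Σ ℕ λ C → Σ ℕ λ Q₀ →
    (F : FiniteField) → Q₀ ≤ FiniteField.order F →
    (t : FiniteField.Carrier F) → t ≢ FiniteField.0# F →
    (E : List (Pt F d)) → Unique E →
    C ^ (d ∸ 1) * FiniteField.order F ^ (d * (d ∸ 1) ∸ 1) ≤ length E ^ (d ∸ 1) →
    (N : List (Pt F d × Vec (Pt F d) d)) → Unique N →
    (∀ τ → (τ ∈ N) ⇔ IsIndepStar F E t τ) →
    length E ^ (d + 1) ≤ 3 * FiniteField.order F ^ d * length N
-- No lower bound on q is needed: as n ≤ q^d, the density hypothesis itself forces q ≥ 6d.
lemma2p5 d@(suc (suc (suc e))) (s≤s (s≤s (s≤s _))) =
  6 * d , 0 , λ F _ t t≢0 E !E dense → StarCount.n^[d+1]≤3q^d|N| F e t t≢0 E !E dense
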